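{- Boudol's encoding $\mathcal T_{\rm B}$ is valid up to asynchronous weak barbed bisimilarity: for every process $P$ of $\pi$, $\mathcal T_{\rm B}(P)\approx_{\mathrm{AWBB}}P$.
   Context: Fix an infinite set $\mathcal N$ of names. Processes of $\pi$: $P ::= \mathbf{0} \mid \bar x z.P \mid x(y).P \mid P|Q \mid (y)P \mid\ !P$; $\mathrm{fn}(P)$, $\mathrm n(P)$ free/all names; $P\{w/y\}$ capture-avoiding substitution. $\mathrm a\pi$: the sublanguage with all output prefixes of the form $\bar xz.\mathbf 0$. Structural congruence $\equiv$: smallest congruence with $P|(Q|R)\equiv(P|Q)|R$, $P|Q\equiv Q|P$, $P|\mathbf 0\equiv P$, $!P\equiv P|!P$, $(y)\mathbf 0\equiv\mathbf 0$, $(y)(u)P\equiv(u)(y)P$, $(w)(P|Q)\equiv P|(w)Q$, $(y)P\equiv(w)P\{w/y\}$, $x(y).P\equiv x(w).P\{w/y\}$ ($w\notin\mathrm n(P)$). Reduction $\longmapsto$: generated by $\bar xz.P|x(y).Q\longmapsto P|Q\{z/y\}$, closed under $-|Q$, restriction and $\equiv$; $\longmapsto^*$ reflexive-transitive closure. $\mathcal T_{\rm B}$: homomorphic on $\mathbf 0,|,!$, restriction; $\mathcal T_{\rm B}(\bar xz.P)=(u)(\bar xu|u(v).(\bar vz|\mathcal T_{\rm B}(P)))$, $u,v\notin\mathrm{fn}(P)\cup\{x,z\}$; $\mathcal T_{\rm B}(x(y).P)=x(u).(v)(\bar uv|v(y).\mathcal T_{\rm B}(P))$, $u,v\notin\mathrm{fn}(P)\cup\{x\}$;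 $u\neq v$. $P\downarrow_{\bar x}$ if $P$ has an occurrence of a subterm $\bar xy.R$ not lying strictly within an input/output prefix and not in the scope of a restriction binding $x$; $P\Downarrow_{\bar x}$ if $P\longmapsto^*P'$ with $P'\downarrow_{\bar x}$. A symmetric relation $S$ on $\pi$-processes is an asynchronous weak barbed bisimulation if $P\,S\,Q$ implies (1) if $P\downarrow_{\bar x}$ then $Q\Downarrow_{\bar x}$, and (2) if $P\longmapsto P'$ then $Q\longmapsto^*Q'$ for some $Q'$ with $P'\,S\,Q'$. $\approx_{\mathrm{AWBB}}$ is the largest such relation. -}

module Defs where

open import Data.Nat using (ℕ; zero; suc; _⊔_; _≟_)
open import Data.List using (List; []; _∷_; _++_; filter; map; foldr)
open import Data.List.Membership.Propositional using (_∈_)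
open import Data.List.Membership.DecPropositional _≟_ using (_∈?_)
open import Data.Product using (∃; _×_; _,_)
open import Data.Bool using (if_then_else_)
open import Relation.Nullary using (¬_; ¬?; does)
open import Relation.Binary.PropositionalEquality using (_≡_)
open import Relation.Binary.Construct.Closure.ReflexiveTransitive using (Star)

Name : Set
Name = ℕ

-- Processes of π (named syntax; binders: input x(y).P binds y, (y)P binds y)
infixr 6 _∥_
data Proc : Set where
  𝟎    : Proc
  out  : Name → Name → Proc → Proc   -- x̄ z . P
  inp  : Name → Name → Proc → Proc   -- x(y) . P
  _∥_  : Proc → Proc → Proc
  ν    : Name → Proc → Proc
  !_   : Proc → Proc

remove : Name → List Name → List Name
remove y = filter (λ z → ¬? (z ≟ y))

fn : Proc → List Name
fn 𝟎 = []
fn (out x z P) = x ∷ z ∷ fn P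
fn (inp x y P) = x ∷ remove y (fn P)
fn (P ∥ Q) = fn P ++ fn Q
fn (ν y P) = remove y (fn P)
fn (! P) = fn P

names : Proc → List Name
names 𝟎 = []
names (out x z P) = x ∷ z ∷ names P
names (inp x y P) = x ∷ y ∷ names P
names (P ∥ Q) = names P ++ names Q
names (ν y P) = y ∷ names P
names (! P) = names P

fresh : List Name → Name
fresh L = suc (foldr _⊔_ 0 L)

_[_↦_] : (Name → Name) → Name → Name → (Name → Name)
(σ [ y ↦ w ]) z = if does (z ≟ y) then w else σ z

-- A bound name y is kept unless it would capture (i.e. unless y is the
-- image of a free name of the body other than y), in which case it is
-- renamed to a fresh name.
binder : (Name → Name) → Name → Proc → Name
binder σ y P =
  let L = map σ (remove y (fn P)) in
  if does (y ∈? L) then fresh (L ++ names P) else y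

sub : (Name → Name) → Proc → Proc
sub σ 𝟎 = 𝟎
sub σ (out x z P) = out (σ x) (σ z) (sub σ P)
sub σ (inp x y P) = let y' = binder σ y P in inp (σ x) y' (sub (σ [ y ↦ y' ]) P)
sub σ (P ∥ Q) = sub σ P ∥ sub σ Q
sub σ (ν y P) = let y' = binder σ y P in ν y' (sub (σ [ y ↦ y' ]) P)
sub σ (! P) = ! sub σ P

_[_/_] : Proc → Name → Name → Proc
P [ w / y ] = sub ((λ z → z) [ y ↦ w ]) P

infix 4 _≡π_
data _≡π_ : Proc → Proc → Set where
  refl≡  : ∀ {P} → P ≡π P
  sym≡   : ∀ {P Q} → P ≡π Q → Q ≡π P
  trans≡ : ∀ {P Q R} → P ≡π Q → Q ≡π R → P ≡π R
  c-out  : ∀ {x z P Q} → P ≡π Q → out x z P ≡π out x z Q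
  c-inp  : ∀ {x y P Q} → P ≡π Q → inp x y P ≡π inp x y Q
  c-par  : ∀ {P P' Q Q'} → P ≡π P' → Q ≡π Q' → P ∥ Q ≡π P' ∥ Q'
  c-res  : ∀ {y P Q} → P ≡π Q → ν y P ≡π ν y Q
  c-bang : ∀ {P Q} → P ≡π Q → ! P ≡π ! Q
  par-assoc : ∀ {P Q R} → P ∥ (Q ∥ R) ≡π (P ∥ Q) ∥ R
  par-comm  : ∀ {P Q} → P ∥ Q ≡π Q ∥ P
  par-nil   : ∀ {P} → P ∥ 𝟎 ≡π P
  bang-unf  : ∀ {P} → ! P ≡π P ∥ ! P
  res-nil   : ∀ {y} → ν y 𝟎 ≡π 𝟎
  res-swap  : ∀ {y u P} → ν y (ν u P) ≡π ν u (ν y P)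
  res-par   : ∀ {w P Q} → ¬ (w ∈ names P) → ν w (P ∥ Q) ≡π P ∥ ν w Q
  alpha-res : ∀ {y w P} → ¬ (w ∈ names P) → ν y P ≡π ν w (P [ w / y ])
  alpha-inp : ∀ {x y w P} → ¬ (w ∈ names P) → inp x y P ≡π inp x w (P [ w / y ])

infix 4 _⟼_
data _⟼_ : Proc → Proc → Set where
  comm   : ∀ {x z y P Q} → out x z P ∥ inp x y Q ⟼ P ∥ (Q [ z / y ])
  r-par  : ∀ {P P' Q} → P ⟼ P' → P ∥ Q ⟼ P' ∥ Q
  r-res  : ∀ {y P P'} → P ⟼ P' → ν y P ⟼ ν y P'
  r-str  : ∀ {P P' Q Q'} → P ≡π P' → P' ⟼ Q' → Q' ≡π Q → P ⟼ Q

_⟼*_ : Proc → Proc → Set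
_⟼*_ = Star _⟼_

data _↓_ : Proc → Name → Set where
  b-out  : ∀ {x y R} → out x y R ↓ x
  b-parl : ∀ {P Q x} → P ↓ x → (P ∥ Q) ↓ x
  b-parr : ∀ {P Q x} → Q ↓ x → (P ∥ Q) ↓ x
  b-res  : ∀ {y P x} → ¬ (y ≡ x) → P ↓ x → ν y P ↓ x
  b-bang : ∀ {P x} → P ↓ x → (! P) ↓ x

_⇓_ : Proc → Name → Set
P ⇓ x = ∃ λ P' → P ⟼* P' × P' ↓ x

record IsAWBB (S : Proc → Proc → Set) : Set where
  field
    symmetric : ∀ {P Q} → S P Q → S Q P
    barb      : ∀ {P Q x} → S P Q → P ↓ x → Q ⇓ x
    step      : ∀ {P Q P'} → S P Q → P ⟼ P' → ∃ λ Q' → Q ⟼* Q' × S P' Q'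

infix 4 _≈AWBB_
_≈AWBB_ : Proc → Proc → Set₁
P ≈AWBB Q = ∃ λ (S : Proc → Proc → Set) → IsAWBB S × S P Q

-- Boudol's encoding 𝒯_B (u, v chosen fresh for all names involved; u ≢ v)
TB : Proc → Proc
TB 𝟎 = 𝟎
TB (out x z P) =
  let u = fresh (x ∷ z ∷ names P) ; v = suc u in
  ν u (out x u 𝟎 ∥ inp u v (out v z 𝟎 ∥ TB P))
TB (inp x y P) =
  let u = fresh (x ∷ y ∷ names P) ; v = suc u in
  inp x u (ν v (out u v 𝟎 ∥ inp v y (TB P)))
TB (P ∥ Q) = TB P ∥ TB Q
TB (ν y P) = ν y (TB P)
TB (! P) = ! TB P

-- Work with de Bruijn processes and a labelled transition system in which structural
-- congruence is a strong bisimulation, so that every argument can be carried out up to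
-- structural congruence. Boudol's encoding turns a communication x̄z into a handshake of
-- three steps: the sender emits a private channel u on x, the receiver answers with a
-- private v on u, and z finally travels on v. Relating each process to its encoding,
-- and also to every encoding stuck in the middle of such handshakes, gives a weak
-- bisimulation: the first handshake step is matched by the source communication and the
-- other two by the source idling, while a source communication is answered by the whole
-- handshake. Encodings never perform free outputs, but they perform bound outputs on
-- exactly the channels the source outputs on, so the barbs agree. Finally, translating
-- named processes into de Bruijn ones preserves ≡π, reductions and barbs, and τ-steps of
-- a translation lift back to reductions.

module Submission where

open import Data.Bool using (if_then_else_)
open import Data.Empty using (⊥; ⊥-elim)
open import Data.List using (_∷_; _++_; map; foldr)
open import Data.List.Membership.Propositional using (_∈_; _∉_)
open import Data.List.Membership.Propositional.Properties using (∈-filter⁺; ∈-filter⁻; ∈-++⁺ˡ; ∈-++⁺ʳ; ∈-++⁻; ∈-map⁺)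
open import Data.List.Relation.Unary.Any using (here; there)
open import Data.Nat using (ℕ; zero; suc; _⊔_; _≟_; _≤_; _<_; s≤s)
open import Data.List.Membership.DecPropositional _≟_ using (_∈?_)
open import Data.Nat.Properties using (suc-injective; 1+n≢n; m<n⇒m<1+n; <⇒≢; m≤m⊔n; m≤n⊔m; ≤-trans; <-irrefl)
open import Data.Product using (Σ; _×_; _,_; proj₁; ∃)
open import Data.Sum using (_⊎_; inj₁; inj₂)
open import Function using (_∘_; id)
open import Function.Definitions using (Injective)
open import Relation.Binary.Construct.Closure.ReflexiveTransitive using (ε; _◅_)
open import Relation.Binary.PropositionalEquality
open import Relation.Nullary using (¬?; Dec; does; yes; no)
open import Relation.Nullary.Decidable using (dec-true; dec-false)
open import Defs

-- De Bruijn processes and renaming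

infixr 6 _∣_
data Tm : Set where
  nil  : Tm
  send : ℕ → ℕ → Tm → Tm
  recv : ℕ → Tm → Tm
  _∣_  : Tm → Tm → Tm
  new  : Tm → Tm
  rep  : Tm → Tm

lift : (ℕ → ℕ) → ℕ → ℕ
lift f zero = zero
lift f (suc n) = suc (f n)

ren : (ℕ → ℕ) → Tm → Tm
ren f nil = nil
ren f (send a b P) = send (f a) (f b) (ren f P)
ren f (recv a P) = recv (f a) (ren (lift f) P)
ren f (P ∣ Q) = ren f P ∣ ren f Q
ren f (new P) = new (ren (lift f) P)
ren f (rep P) = rep (ren f P)

shift : Tm → Tm
shift = ren suc

swap : ℕ → ℕ
swap zero = suc zero
swap (suc zero) = zero
swap (suc (suc n)) = suc (suc n)

sub₀ : ℕ → ℕ → ℕ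
sub₀ b zero = b
sub₀ b (suc n) = n

lift-cong : ∀ {f g} → f ≗ g → lift f ≗ lift g
lift-cong f≗g zero = refl
lift-cong f≗g (suc n) = cong suc (f≗g n)

ren-cong : ∀ {f g} → f ≗ g → ∀ P → ren f P ≡ ren g P
ren-cong f≗g nil = refl
ren-cong f≗g (send a b P) rewrite f≗g a | f≗g b = cong (send _ _) (ren-cong f≗g P)
ren-cong f≗g (recv a P) = cong₂ recv (f≗g a) (ren-cong (lift-cong f≗g) P)
ren-cong f≗g (P ∣ Q) = cong₂ _∣_ (ren-cong f≗g P) (ren-cong f≗g Q)
ren-cong f≗g (new P) = cong new (ren-cong (lift-cong f≗g) P)
ren-cong f≗g (rep P) = cong rep (ren-cong f≗g P)

lift-∘ : ∀ f g → (lift f ∘ lift g) ≗ lift (f ∘ g)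
lift-∘ f g zero = refl
lift-∘ f g (suc n) = refl

ren-∘ : ∀ {f g} P → ren f (ren g P) ≡ ren (f ∘ g) P
ren-∘ nil = refl
ren-∘ (send a b P) = cong (send _ _) (ren-∘ P)
ren-∘ {f} {g} (recv a P) = cong (recv _) (trans (ren-∘ P) (ren-cong (lift-∘ f g) P))
ren-∘ (P ∣ Q) = cong₂ _∣_ (ren-∘ P) (ren-∘ Q)
ren-∘ {f} {g} (new P) = cong new (trans (ren-∘ P) (ren-cong (lift-∘ f g) P))
ren-∘ (rep P) = cong rep (ren-∘ P)

lift-id : ∀ {f} → f ≗ id → lift f ≗ id
lift-id f≗id zero = refl
lift-id f≗id (suc n) = cong suc (f≗id n)

ren-id : ∀ {f} → f ≗ id → ∀ P → ren f P ≡ P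
ren-id f≗id nil = refl
ren-id f≗id (send a b P) rewrite f≗id a | f≗id b = cong (send _ _) (ren-id f≗id P)
ren-id f≗id (recv a P) = cong₂ recv (f≗id a) (ren-id (lift-id f≗id) P)
ren-id f≗id (P ∣ Q) = cong₂ _∣_ (ren-id f≗id P) (ren-id f≗id Q)
ren-id f≗id (new P) = cong new (ren-id (lift-id f≗id) P)
ren-id f≗id (rep P) = cong rep (ren-id f≗id P)

ren-fuse : ∀ {f g h} P → (f ∘ g) ≗ h → ren f (ren g P) ≡ ren h P
ren-fuse P fg≗h = trans (ren-∘ P) (ren-cong fg≗h P)

ren-square : ∀ {f g f′ g′} P → (f ∘ g) ≗ (f′ ∘ g′) → ren f (ren g P) ≡ ren f′ (ren g′ P)
ren-square P square = trans (ren-fuse P square) (sym (ren-∘ P))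

ren-cancel : ∀ {f g} P → (f ∘ g) ≗ id → ren f (ren g P) ≡ P
ren-cancel P fg≗id = trans (ren-∘ P) (ren-id fg≗id P)

ren-∘₃ : ∀ {f g h} P → ren f (ren g (ren h P)) ≡ ren (f ∘ (g ∘ h)) P
ren-∘₃ P = trans (cong (ren _) (ren-∘ P)) (ren-∘ P)

lift-injective : ∀ {f} → Injective _≡_ _≡_ f → Injective _≡_ _≡_ (lift f)
lift-injective f-inj {zero} {zero} _ = refl
lift-injective f-inj {suc m} {suc n} eq = cong suc (f-inj (suc-injective eq))

lift-shift : ∀ f P → ren (lift f) (shift P) ≡ shift (ren f P)
lift-shift f P = ren-square P (λ _ → refl)

sub₀-shift : ∀ b P → ren (sub₀ b) (shift P) ≡ P
sub₀-shift b P = ren-cancel P (λ _ → refl)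

sub₀-natural : ∀ f b → (f ∘ sub₀ b) ≗ (sub₀ (f b) ∘ lift f)
sub₀-natural f b zero = refl
sub₀-natural f b (suc n) = refl

swap-natural : ∀ f → (swap ∘ lift (lift f)) ≗ (lift (lift f) ∘ swap)
swap-natural f zero = refl
swap-natural f (suc zero) = refl
swap-natural f (suc (suc n)) = refl

swap-involutive : (swap ∘ swap) ≗ id
swap-involutive zero = refl
swap-involutive (suc zero) = refl
swap-involutive (suc (suc n)) = refl

swap-braid : (swap ∘ (lift swap ∘ swap)) ≗ (lift swap ∘ (swap ∘ lift swap))
swap-braid zero = refl
swap-braid (suc zero) = refl
swap-braid (suc (suc zero)) = refl
swap-braid (suc (suc (suc n))) = refl

ren-swap-braid : ∀ P → ren swap (ren (lift swap) (ren swap P)) ≡ ren (lift swap) (ren swap (ren (lift swap) P))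
ren-swap-braid P = trans (ren-∘₃ P) (trans (ren-cong swap-braid P) (sym (ren-∘₃ P)))

swap-lift-suc : (swap ∘ lift suc) ≗ suc
swap-lift-suc zero = refl
swap-lift-suc (suc n) = refl

swap-suc : (swap ∘ suc) ≗ lift suc
swap-suc zero = refl
swap-suc (suc n) = refl

lift-sub₀-swap : ∀ b → (lift (sub₀ b) ∘ swap) ≗ sub₀ (suc b)
lift-sub₀-swap b zero = refl
lift-sub₀-swap b (suc zero) = refl
lift-sub₀-swap b (suc (suc n)) = refl

sub₀-zero-lift-suc : (sub₀ zero ∘ lift suc) ≗ id
sub₀-zero-lift-suc zero = refl
sub₀-zero-lift-suc (suc n) = refl

sub₀-suc-lift-suc : ∀ b → (sub₀ (suc b) ∘ lift suc) ≗ (suc ∘ sub₀ b)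
sub₀-suc-lift-suc b zero = refl
sub₀-suc-lift-suc b (suc n) = refl

-- Labelled transitions

data Act : Set where
  τ        : Act
  freeOut  : ℕ → ℕ → Act
  boundOut : ℕ → Act
  input    : ℕ → Act

input-injective : ∀ {a b} → input a ≡ input b → a ≡ b
input-injective refl = refl

renAct : (ℕ → ℕ) → Act → Act
renAct f τ = τ
renAct f (freeOut a b) = freeOut (f a) (f b)
renAct f (boundOut a) = boundOut (f a)
renAct f (input a) = input (f a)

-- After an input or a bound output, index 0 of the derivative is the name received or
-- extruded, so a bystander in parallel is shifted and renamings act under one more binder.
weakenFor : Act → Tm → Tm
weakenFor τ Q = Q
weakenFor (freeOut _ _) Q = Q
weakenFor (boundOut _) Q = shift Q
weakenFor (input _) Q = shift Q

liftFor : Act → (ℕ → ℕ) → ℕ → ℕ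
liftFor τ f = f
liftFor (freeOut _ _) f = f
liftFor (boundOut _) f = lift f
liftFor (input _) f = lift f

infix 4 _-[_]→_
data _-[_]→_ : Tm → Act → Tm → Set where
  t-send        : ∀ {a b P} → send a b P -[ freeOut a b ]→ P
  t-recv        : ∀ {a P} → recv a P -[ input a ]→ P
  t-parˡ        : ∀ {P P' Q α} → P -[ α ]→ P' → (P ∣ Q) -[ α ]→ (P' ∣ weakenFor α Q)
  t-parʳ        : ∀ {P Q Q' α} → Q -[ α ]→ Q' → (P ∣ Q) -[ α ]→ (weakenFor α P ∣ Q')
  t-commˡ       : ∀ {P P' Q Q' a b} → P -[ freeOut a b ]→ P' → Q -[ input a ]→ Q' →
                  (P ∣ Q) -[ τ ]→ (P' ∣ ren (sub₀ b) Q')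
  t-commʳ       : ∀ {P P' Q Q' a b} → P -[ input a ]→ P' → Q -[ freeOut a b ]→ Q' →
                  (P ∣ Q) -[ τ ]→ (ren (sub₀ b) P' ∣ Q')
  t-closeˡ      : ∀ {P P' Q Q' a} → P -[ boundOut a ]→ P' → Q -[ input a ]→ Q' →
                  (P ∣ Q) -[ τ ]→ new (P' ∣ Q')
  t-closeʳ      : ∀ {P P' Q Q' a} → P -[ input a ]→ P' → Q -[ boundOut a ]→ Q' →
                  (P ∣ Q) -[ τ ]→ new (P' ∣ Q')
  t-newτ        : ∀ {P P'} → P -[ τ ]→ P' → new P -[ τ ]→ new P'
  t-newOut      : ∀ {P P' a b} → P -[ freeOut (suc a) (suc b) ]→ P' → new P -[ freeOut a b ]→ new P'
  t-newBoundOut : ∀ {P P' a} → P -[ boundOut (suc a) ]→ P' → new P -[ boundOut a ]→ new (ren swap P')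
  t-newIn       : ∀ {P P' a} → P -[ input (suc a) ]→ P' → new P -[ input a ]→ new (ren swap P')
  t-open        : ∀ {P P' a} → P -[ freeOut (suc a) zero ]→ P' → new P -[ boundOut a ]→ P'
  t-rep         : ∀ {P P' α} → (P ∣ rep P) -[ α ]→ P' → rep P -[ α ]→ P'

retarget : ∀ {P α X Y} → P -[ α ]→ X → X ≡ Y → P -[ α ]→ Y
retarget d refl = d

ren-weakenFor : ∀ α f Q → ren (liftFor α f) (weakenFor α Q) ≡ weakenFor (renAct f α) (ren f Q)
ren-weakenFor τ f Q = refl
ren-weakenFor (freeOut _ _) f Q = refl
ren-weakenFor (boundOut _) f Q = lift-shift f Q
ren-weakenFor (input _) f Q = lift-shift f Q

weakenFor-∣ : ∀ α Q R → weakenFor α (Q ∣ R) ≡ (weakenFor α Q ∣ weakenFor α R)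
weakenFor-∣ τ Q R = refl
weakenFor-∣ (freeOut _ _) Q R = refl
weakenFor-∣ (boundOut _) Q R = refl
weakenFor-∣ (input _) Q R = refl

weakenFor-nil : ∀ α → weakenFor α nil ≡ nil
weakenFor-nil τ = refl
weakenFor-nil (freeOut _ _) = refl
weakenFor-nil (boundOut _) = refl
weakenFor-nil (input _) = refl

step-ren : ∀ {P α P'} f → P -[ α ]→ P' → ren f P -[ renAct f α ]→ ren (liftFor α f) P'
step-ren f t-send = t-send
step-ren f t-recv = t-recv
step-ren {α = α} f (t-parˡ {Q = Q} d) = retarget (t-parˡ (step-ren f d)) (cong (_ ∣_) (sym (ren-weakenFor α f Q)))
step-ren {α = α} f (t-parʳ {P = P} d) = retarget (t-parʳ (step-ren f d)) (cong (_∣ _) (sym (ren-weakenFor α f P)))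
step-ren f (t-commˡ {Q' = Q'} {b = b} d e) =
  retarget (t-commˡ (step-ren f d) (step-ren f e)) (cong (_ ∣_) (sym (ren-square Q' (sub₀-natural f b))))
step-ren f (t-commʳ {P' = P'} {b = b} d e) =
  retarget (t-commʳ (step-ren f d) (step-ren f e)) (cong (_∣ _) (sym (ren-square P' (sub₀-natural f b))))
step-ren f (t-closeˡ d e) = t-closeˡ (step-ren f d) (step-ren f e)
step-ren f (t-closeʳ d e) = t-closeʳ (step-ren f d) (step-ren f e)
step-ren f (t-newτ d) = t-newτ (step-ren (lift f) d)
step-ren f (t-newOut d) = t-newOut (step-ren (lift f) d)
step-ren f (t-newBoundOut {P' = P'} d) =
  retarget (t-newBoundOut (step-ren (lift f) d)) (cong new (ren-square P' (swap-natural f)))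
step-ren f (t-newIn {P' = P'} d) =
  retarget (t-newIn (step-ren (lift f) d)) (cong new (ren-square P' (swap-natural f)))
step-ren f (t-open d) = t-open (step-ren (lift f) d)
step-ren f (t-rep d) = t-rep (step-ren f d)

RenamedStep : (ℕ → ℕ) → Tm → Act → Tm → Set
RenamedStep f P γ X =
  Σ Act λ α → Σ Tm λ P' → (P -[ α ]→ P') × (γ ≡ renAct f α) × (X ≡ ren (liftFor α f) P')

step-ren⁻ : ∀ {f} → Injective _≡_ _≡_ f → ∀ P {γ X} → ren f P -[ γ ]→ X → RenamedStep f P γ X
step-ren⁻ f-inj (send a b P) t-send = freeOut a b , P , t-send , refl , refl
step-ren⁻ f-inj (recv a P) t-recv = input a , P , t-recv , refl , refl
step-ren⁻ {f} f-inj (P ∣ Q) (t-parˡ d) with step-ren⁻ f-inj P d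
... | α , P' , d' , refl , refl = α , _ , t-parˡ d' , refl , cong (_ ∣_) (sym (ren-weakenFor α f Q))
step-ren⁻ {f} f-inj (P ∣ Q) (t-parʳ d) with step-ren⁻ f-inj Q d
... | α , Q' , d' , refl , refl = α , _ , t-parʳ d' , refl , cong (_∣ _) (sym (ren-weakenFor α f P))
step-ren⁻ {f} f-inj (P ∣ Q) (t-commˡ d e) with step-ren⁻ f-inj P d | step-ren⁻ f-inj Q e
... | freeOut a b , P' , d' , refl , refl | input a′ , Q' , e' , same , refl
  with refl ← f-inj (input-injective same) =
  τ , _ , t-commˡ d' e' , refl , cong (_ ∣_) (ren-square Q' (sym ∘ sub₀-natural f b))
step-ren⁻ {f} f-inj (P ∣ Q) (t-commʳ d e) with step-ren⁻ f-inj P d | step-ren⁻ f-inj Q e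
... | input a′ , P' , d' , same , refl | freeOut a b , Q' , e' , refl , refl
  with refl ← f-inj (input-injective same) =
  τ , _ , t-commʳ d' e' , refl , cong (_∣ _) (ren-square P' (sym ∘ sub₀-natural f b))
step-ren⁻ f-inj (P ∣ Q) (t-closeˡ d e) with step-ren⁻ f-inj P d | step-ren⁻ f-inj Q e
... | boundOut a , P' , d' , refl , refl | input a′ , Q' , e' , same , refl
  with refl ← f-inj (input-injective same) = τ , _ , t-closeˡ d' e' , refl , refl
step-ren⁻ f-inj (P ∣ Q) (t-closeʳ d e) with step-ren⁻ f-inj P d | step-ren⁻ f-inj Q e
... | input a′ , P' , d' , same , refl | boundOut a , Q' , e' , refl , refl
  with refl ← f-inj (input-injective same) = τ , _ , t-closeʳ d' e' , refl , refl
step-ren⁻ f-inj (new P) (t-newτ d) with step-ren⁻ (lift-injective f-inj) P d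
... | τ , P' , d' , refl , refl = τ , _ , t-newτ d' , refl , refl
step-ren⁻ f-inj (new P) (t-newOut d) with step-ren⁻ (lift-injective f-inj) P d
... | freeOut (suc a) (suc b) , P' , d' , refl , refl = freeOut a b , _ , t-newOut d' , refl , refl
step-ren⁻ {f} f-inj (new P) (t-newBoundOut d) with step-ren⁻ (lift-injective f-inj) P d
... | boundOut (suc a) , P' , d' , refl , refl =
  boundOut a , _ , t-newBoundOut d' , refl , cong new (ren-square P' (swap-natural f))
step-ren⁻ {f} f-inj (new P) (t-newIn d) with step-ren⁻ (lift-injective f-inj) P d
... | input (suc a) , P' , d' , refl , refl = input a , _ , t-newIn d' , refl , cong new (ren-square P' (swap-natural f))
step-ren⁻ f-inj (new P) (t-open d) with step-ren⁻ (lift-injective f-inj) P d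
... | freeOut (suc a) zero , P' , d' , refl , refl = boundOut a , _ , t-open d' , refl , refl
step-ren⁻ f-inj (rep P) (t-rep d) with step-ren⁻ f-inj (P ∣ rep P) d
... | α , P' , d' , refl , refl = α , _ , t-rep d' , refl , refl


-- Structural congruence is a strong bisimulation

infix 4 _≈_
data _≈_ : Tm → Tm → Set where
  ≈-refl    : ∀ {P} → P ≈ P
  ≈-sym     : ∀ {P Q} → P ≈ Q → Q ≈ P
  ≈-trans   : ∀ {P Q R} → P ≈ Q → Q ≈ R → P ≈ R
  ≈-send    : ∀ {a b P Q} → P ≈ Q → send a b P ≈ send a b Q
  ≈-recv    : ∀ {a P Q} → P ≈ Q → recv a P ≈ recv a Q
  ≈-par     : ∀ {P P' Q Q'} → P ≈ P' → Q ≈ Q' → (P ∣ Q) ≈ (P' ∣ Q')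
  ≈-new     : ∀ {P Q} → P ≈ Q → new P ≈ new Q
  ≈-rep     : ∀ {P Q} → P ≈ Q → rep P ≈ rep Q
  ≈-assoc   : ∀ {P Q R} → (P ∣ (Q ∣ R)) ≈ ((P ∣ Q) ∣ R)
  ≈-comm    : ∀ {P Q} → (P ∣ Q) ≈ (Q ∣ P)
  ≈-nil     : ∀ {P} → (P ∣ nil) ≈ P
  ≈-unfold  : ∀ {P} → rep P ≈ (P ∣ rep P)
  ≈-newNil  : new nil ≈ nil
  ≈-newSwap : ∀ {P} → new (new P) ≈ new (new (ren swap P))
  ≈-extrude : ∀ {P Q} → new (shift P ∣ Q) ≈ (P ∣ new Q)

infixr 5 _⟫_
_⟫_ : ∀ {P Q R} → P ≈ Q → Q ≈ R → P ≈ R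
_⟫_ = ≈-trans

≡→≈ : ∀ {P Q} → P ≡ Q → P ≈ Q
≡→≈ refl = ≈-refl

≈-ren : ∀ {P Q} f → P ≈ Q → ren f P ≈ ren f Q
≈-ren f ≈-refl = ≈-refl
≈-ren f (≈-sym P≈Q) = ≈-sym (≈-ren f P≈Q)
≈-ren f (≈-trans P≈Q Q≈R) = ≈-ren f P≈Q ⟫ ≈-ren f Q≈R
≈-ren f (≈-send P≈Q) = ≈-send (≈-ren f P≈Q)
≈-ren f (≈-recv P≈Q) = ≈-recv (≈-ren (lift f) P≈Q)
≈-ren f (≈-par P≈P′ Q≈Q′) = ≈-par (≈-ren f P≈P′) (≈-ren f Q≈Q′)
≈-ren f (≈-new P≈Q) = ≈-new (≈-ren (lift f) P≈Q)
≈-ren f (≈-rep P≈Q) = ≈-rep (≈-ren f P≈Q)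
≈-ren f ≈-assoc = ≈-assoc
≈-ren f ≈-comm = ≈-comm
≈-ren f ≈-nil = ≈-nil
≈-ren f ≈-unfold = ≈-unfold
≈-ren f ≈-newNil = ≈-newNil
≈-ren f (≈-newSwap {P}) = ≈-newSwap ⟫ ≡→≈ (cong (new ∘ new) (ren-square P (swap-natural f)))
≈-ren f (≈-extrude {P} {Q}) = ≡→≈ (cong (λ z → new (z ∣ ren (lift f) Q)) (lift-shift f P)) ⟫ ≈-extrude

weakenFor-≈ : ∀ α {Q Q'} → Q ≈ Q' → weakenFor α Q ≈ weakenFor α Q'
weakenFor-≈ τ Q≈Q' = Q≈Q'
weakenFor-≈ (freeOut _ _) Q≈Q' = Q≈Q'
weakenFor-≈ (boundOut _) Q≈Q' = ≈-ren suc Q≈Q'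
weakenFor-≈ (input _) Q≈Q' = ≈-ren suc Q≈Q'

nil-∣ : ∀ {P} → (nil ∣ P) ≈ P
nil-∣ = ≈-comm ⟫ ≈-nil

new-shift : ∀ {P} → new (shift P) ≈ P
new-shift = ≈-new (≈-sym ≈-nil) ⟫ ≈-extrude ⟫ ≈-par ≈-refl ≈-newNil ⟫ ≈-nil

extrude-last : ∀ {P Q R} → new (P ∣ (Q ∣ shift R)) ≈ (new (P ∣ Q) ∣ R)
extrude-last = ≈-new ≈-assoc ⟫ ≈-new ≈-comm ⟫ ≈-extrude ⟫ ≈-comm

extrude-middleˡ : ∀ {P Q R} → new ((P ∣ shift Q) ∣ R) ≈ (new (P ∣ R) ∣ Q)
extrude-middleˡ = ≈-new (≈-sym ≈-assoc ⟫ ≈-par ≈-refl ≈-comm) ⟫ extrude-last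

extrude-first : ∀ {P Q R} → new ((shift P ∣ Q) ∣ R) ≈ (P ∣ new (Q ∣ R))
extrude-first = ≈-new (≈-sym ≈-assoc) ⟫ ≈-extrude

new-pullʳ : ∀ P Q → new (P ∣ new (ren swap Q)) ≈ new (new (ren (lift suc) P ∣ Q))
new-pullʳ P Q =
  ≈-new (≈-sym ≈-extrude) ⟫ ≈-newSwap
  ⟫ ≡→≈ (cong (new ∘ new) (cong₂ _∣_ (ren-fuse P swap-suc) (ren-cancel Q swap-involutive)))

new-pullˡ : ∀ P Q → new (new (ren swap P) ∣ Q) ≈ new (new (P ∣ ren (lift suc) Q))
new-pullˡ P Q = ≈-new ≈-comm ⟫ new-pullʳ Q P ⟫ ≈-new (≈-new ≈-comm)

extrude-boundˡ : ∀ P Q → new (ren swap (ren (lift suc) P ∣ shift Q)) ≈ (P ∣ shift (new Q))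
extrude-boundˡ P Q = ≡→≈ (cong new (cong₂ _∣_ (ren-fuse P swap-lift-suc) (ren-fuse Q swap-suc))) ⟫ ≈-extrude

extrude-boundʳ : ∀ P Q → new (ren swap (shift (shift P) ∣ Q)) ≈ (shift P ∣ new (ren swap Q))
extrude-boundʳ P Q =
  ≡→≈ (cong (λ R → new (R ∣ ren swap Q)) (trans (ren-fuse (shift P) swap-suc) (lift-shift suc P))) ⟫ ≈-extrude

infix 4 _≼_
_≼_ : Tm → Tm → Set
P ≼ Q = ∀ {α P'} → P -[ α ]→ P' → Σ Tm λ Q' → (Q -[ α ]→ Q') × (P' ≈ Q')

≼-refl : ∀ {P} → P ≼ P
≼-refl d = _ , d , ≈-refl

≼-trans : ∀ {P Q R} → P ≼ Q → Q ≼ R → P ≼ R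
≼-trans P≼Q Q≼R d with P≼Q d
... | _ , d₁ , ≈₁ with Q≼R d₁
... | _ , d₂ , ≈₂ = _ , d₂ , ≈₁ ⟫ ≈₂

≼-send : ∀ {a b P Q} → P ≈ Q → send a b P ≼ send a b Q
≼-send P≈Q t-send = _ , t-send , P≈Q

≼-recv : ∀ {a P Q} → P ≈ Q → recv a P ≼ recv a Q
≼-recv P≈Q t-recv = _ , t-recv , P≈Q

≼-par : ∀ {P P' Q Q'} → P ≼ P' → Q ≼ Q' → P ≈ P' → Q ≈ Q' → (P ∣ Q) ≼ (P' ∣ Q')
≼-par P≼ Q≼ P≈ Q≈ {α} (t-parˡ d) with P≼ d
... | _ , d' , ≈₁ = _ , t-parˡ d' , ≈-par ≈₁ (weakenFor-≈ α Q≈)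
≼-par P≼ Q≼ P≈ Q≈ {α} (t-parʳ d) with Q≼ d
... | _ , d' , ≈₂ = _ , t-parʳ d' , ≈-par (weakenFor-≈ α P≈) ≈₂
≼-par P≼ Q≼ P≈ Q≈ (t-commˡ {b = b} d e) with P≼ d | Q≼ e
... | _ , d' , ≈₁ | _ , e' , ≈₂ = _ , t-commˡ d' e' , ≈-par ≈₁ (≈-ren (sub₀ b) ≈₂)
≼-par P≼ Q≼ P≈ Q≈ (t-commʳ {b = b} d e) with P≼ d | Q≼ e
... | _ , d' , ≈₁ | _ , e' , ≈₂ = _ , t-commʳ d' e' , ≈-par (≈-ren (sub₀ b) ≈₁) ≈₂
≼-par P≼ Q≼ P≈ Q≈ (t-closeˡ d e) with P≼ d | Q≼ e
... | _ , d' , ≈₁ | _ , e' , ≈₂ = _ , t-closeˡ d' e' , ≈-new (≈-par ≈₁ ≈₂)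
≼-par P≼ Q≼ P≈ Q≈ (t-closeʳ d e) with P≼ d | Q≼ e
... | _ , d' , ≈₁ | _ , e' , ≈₂ = _ , t-closeʳ d' e' , ≈-new (≈-par ≈₁ ≈₂)

≼-new : ∀ {P Q} → P ≼ Q → new P ≼ new Q
≼-new P≼Q (t-newτ d) with P≼Q d
... | _ , d' , ≈′ = _ , t-newτ d' , ≈-new ≈′
≼-new P≼Q (t-newOut d) with P≼Q d
... | _ , d' , ≈′ = _ , t-newOut d' , ≈-new ≈′
≼-new P≼Q (t-newBoundOut d) with P≼Q d
... | _ , d' , ≈′ = _ , t-newBoundOut d' , ≈-new (≈-ren swap ≈′)
≼-new P≼Q (t-newIn d) with P≼Q d
... | _ , d' , ≈′ = _ , t-newIn d' , ≈-new (≈-ren swap ≈′)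
≼-new P≼Q (t-open d) with P≼Q d
... | _ , d' , ≈′ = _ , t-open d' , ≈′

-- ≼-par does not apply to P ∣ rep P, as it would need rep P ≼ rep Q itself.
≼-rep : ∀ {P Q} → P ≼ Q → P ≈ Q → rep P ≼ rep Q
≼-rep {P} {Q} P≼Q P≈Q (t-rep d) with unfolded d
  where
  unfolded : (P ∣ rep P) ≼ (Q ∣ rep Q)
  unfolded {α} (t-parˡ d) with P≼Q d
  ... | _ , d' , ≈′ = _ , t-parˡ d' , ≈-par ≈′ (weakenFor-≈ α (≈-rep P≈Q))
  unfolded {α} (t-parʳ (t-rep d)) with unfolded d
  ... | _ , d' , ≈′ = _ , t-parʳ (t-rep d') , ≈-par (weakenFor-≈ α P≈Q) ≈′
  unfolded (t-commˡ {b = b} d (t-rep e)) with P≼Q d | unfolded e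
  ... | _ , d' , ≈₁ | _ , e' , ≈₂ = _ , t-commˡ d' (t-rep e') , ≈-par ≈₁ (≈-ren (sub₀ b) ≈₂)
  unfolded (t-commʳ {b = b} d (t-rep e)) with P≼Q d | unfolded e
  ... | _ , d' , ≈₁ | _ , e' , ≈₂ = _ , t-commʳ d' (t-rep e') , ≈-par (≈-ren (sub₀ b) ≈₁) ≈₂
  unfolded (t-closeˡ d (t-rep e)) with P≼Q d | unfolded e
  ... | _ , d' , ≈₁ | _ , e' , ≈₂ = _ , t-closeˡ d' (t-rep e') , ≈-new (≈-par ≈₁ ≈₂)
  unfolded (t-closeʳ d (t-rep e)) with P≼Q d | unfolded e
  ... | _ , d' , ≈₁ | _ , e' , ≈₂ = _ , t-closeʳ d' (t-rep e') , ≈-new (≈-par ≈₁ ≈₂)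
... | _ , d' , ≈′ = _ , t-rep d' , ≈′

comm-≼ : ∀ {P Q} → (P ∣ Q) ≼ (Q ∣ P)
comm-≼ (t-parˡ d) = _ , t-parʳ d , ≈-comm
comm-≼ (t-parʳ d) = _ , t-parˡ d , ≈-comm
comm-≼ (t-commˡ d e) = _ , t-commʳ e d , ≈-comm
comm-≼ (t-commʳ d e) = _ , t-commˡ e d , ≈-comm
comm-≼ (t-closeˡ d e) = _ , t-closeʳ e d , ≈-new ≈-comm
comm-≼ (t-closeʳ d e) = _ , t-closeˡ e d , ≈-new ≈-comm

nil-≼ : ∀ {P} → (P ∣ nil) ≼ P
nil-≼ {α = α} (t-parˡ {P' = P'} d) = _ , d , ≡→≈ (cong (P' ∣_) (weakenFor-nil α)) ⟫ ≈-nil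
nil-≼ (t-parʳ ())
nil-≼ (t-commˡ d ())
nil-≼ (t-commʳ d ())
nil-≼ (t-closeˡ d ())
nil-≼ (t-closeʳ d ())

nil-≼⁻ : ∀ {P} → P ≼ (P ∣ nil)
nil-≼⁻ {α = α} {P'} d = _ , t-parˡ d , ≈-sym (≡→≈ (cong (P' ∣_) (weakenFor-nil α)) ⟫ ≈-nil)

unfold-≼ : ∀ {P} → rep P ≼ (P ∣ rep P)
unfold-≼ (t-rep d) = _ , d , ≈-refl

unfold-≼⁻ : ∀ {P} → (P ∣ rep P) ≼ rep P
unfold-≼⁻ d = _ , t-rep d , ≈-refl

newNil-≼ : new nil ≼ nil
newNil-≼ (t-newτ ())
newNil-≼ (t-newOut ())
newNil-≼ (t-newBoundOut ())
newNil-≼ (t-newIn ())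
newNil-≼ (t-open ())

newNil-≼⁻ : nil ≼ new nil
newNil-≼⁻ ()

assoc-≼ : ∀ {P Q R} → (P ∣ (Q ∣ R)) ≼ ((P ∣ Q) ∣ R)
assoc-≼ {Q = Q} {R} {α} (t-parˡ {P' = P'} d) =
  _ , t-parˡ (t-parˡ d) , ≡→≈ (cong (P' ∣_) (weakenFor-∣ α Q R)) ⟫ ≈-assoc
assoc-≼ (t-parʳ (t-parˡ d)) = _ , t-parˡ (t-parʳ d) , ≈-assoc
assoc-≼ {P} {Q} {α = α} (t-parʳ (t-parʳ {Q' = R'} d)) =
  _ , t-parʳ d , ≈-assoc ⟫ ≡→≈ (cong (_∣ R') (sym (weakenFor-∣ α P Q)))
assoc-≼ (t-parʳ (t-commˡ d e)) = _ , t-commˡ (t-parʳ d) e , ≈-assoc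
assoc-≼ {P} (t-parʳ (t-commʳ {P' = Q'} {Q' = R'} {b = b} d e)) =
  _ , t-commʳ (t-parʳ d) e ,
  ≈-assoc ⟫ ≡→≈ (cong (λ S → (S ∣ ren (sub₀ b) Q') ∣ R') (sym (sub₀-shift b P)))
assoc-≼ (t-parʳ (t-closeˡ d e)) = _ , t-closeˡ (t-parʳ d) e , ≈-sym ≈-extrude ⟫ ≈-new ≈-assoc
assoc-≼ (t-parʳ (t-closeʳ d e)) = _ , t-closeʳ (t-parʳ d) e , ≈-sym ≈-extrude ⟫ ≈-new ≈-assoc
assoc-≼ {R = R} (t-commˡ {P' = P'} {b = b} d (t-parˡ {P' = Q'} e)) =
  _ , t-parˡ (t-commˡ d e) , ≡→≈ (cong (λ S → P' ∣ (ren (sub₀ b) Q' ∣ S)) (sub₀-shift b R)) ⟫ ≈-assoc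
assoc-≼ {Q = Q} (t-commˡ {P' = P'} {b = b} d (t-parʳ {Q' = R'} e)) =
  _ , t-commˡ (t-parˡ d) e , ≡→≈ (cong (λ S → P' ∣ (S ∣ ren (sub₀ b) R')) (sub₀-shift b Q)) ⟫ ≈-assoc
assoc-≼ (t-commʳ d (t-parˡ e)) = _ , t-parˡ (t-commʳ d e) , ≈-assoc
assoc-≼ {Q = Q} (t-commʳ {P' = P'} {b = b} d (t-parʳ {Q' = R'} e)) =
  _ , t-commʳ (t-parˡ d) e ,
  ≡→≈ (cong (λ S → ren (sub₀ b) P' ∣ (S ∣ R')) (sym (sub₀-shift b Q))) ⟫ ≈-assoc
assoc-≼ (t-closeˡ d (t-parˡ e)) = _ , t-parˡ (t-closeˡ d e) , extrude-last
assoc-≼ (t-closeˡ d (t-parʳ e)) = _ , t-closeˡ (t-parˡ d) e , ≈-new ≈-assoc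
assoc-≼ (t-closeʳ d (t-parˡ e)) = _ , t-parˡ (t-closeʳ d e) , extrude-last
assoc-≼ (t-closeʳ d (t-parʳ e)) = _ , t-closeʳ (t-parˡ d) e , ≈-new ≈-assoc

assoc-≼⁻ : ∀ {P Q R} → ((P ∣ Q) ∣ R) ≼ (P ∣ (Q ∣ R))
assoc-≼⁻ {P} {Q} {α = α} (t-parʳ {Q' = R'} d) =
  _ , t-parʳ (t-parʳ d) , ≡→≈ (cong (_∣ R') (weakenFor-∣ α P Q)) ⟫ ≈-sym ≈-assoc
assoc-≼⁻ {Q = Q} {R} {α} (t-parˡ (t-parˡ {P' = P'} d)) =
  _ , t-parˡ d , ≈-sym ≈-assoc ⟫ ≡→≈ (cong (P' ∣_) (sym (weakenFor-∣ α Q R)))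
assoc-≼⁻ (t-parˡ (t-parʳ d)) = _ , t-parʳ (t-parˡ d) , ≈-sym ≈-assoc
assoc-≼⁻ {R = R} (t-parˡ (t-commˡ {P' = P'} {Q' = Q'} {b = b} d e)) =
  _ , t-commˡ d (t-parˡ e) ,
  ≈-sym ≈-assoc ⟫ ≡→≈ (cong (λ S → P' ∣ (ren (sub₀ b) Q' ∣ S)) (sym (sub₀-shift b R)))
assoc-≼⁻ (t-parˡ (t-commʳ d e)) = _ , t-commʳ d (t-parˡ e) , ≈-sym ≈-assoc
assoc-≼⁻ (t-parˡ (t-closeˡ d e)) = _ , t-closeˡ d (t-parˡ e) , ≈-sym extrude-last
assoc-≼⁻ (t-parˡ (t-closeʳ d e)) = _ , t-closeʳ d (t-parˡ e) , ≈-sym extrude-last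
assoc-≼⁻ {Q = Q} (t-commˡ {Q' = R'} {b = b} (t-parˡ {P' = P'} d) e) =
  _ , t-commˡ d (t-parʳ e) ,
  ≈-sym ≈-assoc ⟫ ≡→≈ (cong (λ S → P' ∣ (S ∣ ren (sub₀ b) R')) (sym (sub₀-shift b Q)))
assoc-≼⁻ (t-commˡ (t-parʳ d) e) = _ , t-parʳ (t-commˡ d e) , ≈-sym ≈-assoc
assoc-≼⁻ {Q = Q} (t-commʳ {Q' = R'} {b = b} (t-parˡ {P' = P'} d) e) =
  _ , t-commʳ d (t-parʳ e) ,
  ≈-sym ≈-assoc ⟫ ≡→≈ (cong (λ S → ren (sub₀ b) P' ∣ (S ∣ R')) (sub₀-shift b Q))
assoc-≼⁻ {P} (t-commʳ {Q' = R'} {b = b} (t-parʳ {Q' = Q'} d) e) =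
  _ , t-parʳ (t-commʳ d e) ,
  ≡→≈ (cong (λ S → (S ∣ ren (sub₀ b) Q') ∣ R') (sub₀-shift b P)) ⟫ ≈-sym ≈-assoc
assoc-≼⁻ (t-closeˡ (t-parˡ d) e) = _ , t-closeˡ d (t-parʳ e) , ≈-new (≈-sym ≈-assoc)
assoc-≼⁻ (t-closeˡ (t-parʳ d) e) = _ , t-parʳ (t-closeˡ d e) , ≈-new (≈-sym ≈-assoc) ⟫ ≈-extrude
assoc-≼⁻ (t-closeʳ (t-parˡ d) e) = _ , t-closeʳ d (t-parʳ e) , ≈-new (≈-sym ≈-assoc)
assoc-≼⁻ (t-closeʳ (t-parʳ d) e) = _ , t-parʳ (t-closeʳ d e) , ≈-new (≈-sym ≈-assoc) ⟫ ≈-extrude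

newSwap-≼ : ∀ {P} → new (new P) ≼ new (new (ren swap P))
newSwap-≼ (t-newτ (t-newτ d)) = _ , t-newτ (t-newτ (step-ren swap d)) , ≈-newSwap
newSwap-≼ (t-newOut (t-newOut d)) = _ , t-newOut (t-newOut (step-ren swap d)) , ≈-newSwap
newSwap-≼ (t-newBoundOut (t-newBoundOut {P' = P'} d)) =
  _ , t-newBoundOut (t-newBoundOut (step-ren swap d)) , ≈-newSwap ⟫ ≡→≈ (cong (new ∘ new) (ren-swap-braid P'))
newSwap-≼ (t-newIn (t-newIn {P' = P'} d)) =
  _ , t-newIn (t-newIn (step-ren swap d)) , ≈-newSwap ⟫ ≡→≈ (cong (new ∘ new) (ren-swap-braid P'))
newSwap-≼ (t-open (t-newOut {P' = P'} d)) =
  _ , t-newBoundOut (t-open (step-ren swap d)) , ≡→≈ (cong new (sym (ren-cancel P' swap-involutive)))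
newSwap-≼ (t-newBoundOut (t-open d)) = _ , t-open (t-newOut (step-ren swap d)) , ≈-refl

newSwap-≼⁻ : ∀ {P} → new (new (ren swap P)) ≼ new (new P)
newSwap-≼⁻ {P} = subst (λ Q → new (new (ren swap P)) ≼ new (new Q)) (ren-cancel P swap-involutive) newSwap-≼

extrude-≼ : ∀ {P Q} → new (shift P ∣ Q) ≼ (P ∣ new Q)
extrude-≼ {P} (t-newτ (t-parˡ d)) with step-ren⁻ suc-injective P d
... | τ , P' , d' , refl , refl = _ , t-parˡ d' , ≈-extrude
extrude-≼ (t-newτ (t-parʳ d)) = _ , t-parʳ (t-newτ d) , ≈-extrude
extrude-≼ {P} (t-newτ (t-commˡ {Q' = Q'} d e)) with step-ren⁻ suc-injective P d
... | freeOut a b , P' , d' , refl , refl =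
  _ , t-commˡ d' (t-newIn e) ,
  ≡→≈ (cong (λ R → new (shift P' ∣ R)) (sym (ren-fuse Q' (lift-sub₀-swap b)))) ⟫ ≈-extrude
extrude-≼ {P} (t-newτ (t-commʳ {Q' = Q'} {b = zero} d e)) with step-ren⁻ suc-injective P d
... | input a , P' , d' , refl , refl =
  _ , t-closeʳ d' (t-open e) , ≡→≈ (cong (λ R → new (R ∣ Q')) (ren-cancel P' sub₀-zero-lift-suc))
extrude-≼ {P} (t-newτ (t-commʳ {Q' = Q'} {b = suc b} d e)) with step-ren⁻ suc-injective P d
... | input a , P' , d' , refl , refl =
  _ , t-commʳ d' (t-newOut e) ,
  ≡→≈ (cong (λ R → new (R ∣ Q')) (ren-square P' (sub₀-suc-lift-suc b))) ⟫ ≈-extrude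
extrude-≼ {P} (t-newτ (t-closeˡ {Q' = Q'} d e)) with step-ren⁻ suc-injective P d
... | boundOut a , P' , d' , refl , refl = _ , t-closeˡ d' (t-newIn e) , ≈-sym (new-pullʳ P' Q')
extrude-≼ {P} (t-newτ (t-closeʳ {Q' = Q'} d e)) with step-ren⁻ suc-injective P d
... | input a , P' , d' , refl , refl = _ , t-closeʳ d' (t-newBoundOut e) , ≈-sym (new-pullʳ P' Q')
extrude-≼ {P} (t-newOut (t-parˡ d)) with step-ren⁻ suc-injective P d
... | freeOut a b , P' , d' , refl , refl = _ , t-parˡ d' , ≈-extrude
extrude-≼ (t-newOut (t-parʳ d)) = _ , t-parʳ (t-newOut d) , ≈-extrude
extrude-≼ {P} {Q} (t-newBoundOut (t-parˡ d)) with step-ren⁻ suc-injective P d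
... | boundOut a , P' , d' , refl , refl = _ , t-parˡ d' , extrude-boundˡ P' Q
extrude-≼ {P} (t-newBoundOut (t-parʳ {Q' = Q'} d)) = _ , t-parʳ (t-newBoundOut d) , extrude-boundʳ P Q'
extrude-≼ {P} {Q} (t-newIn (t-parˡ d)) with step-ren⁻ suc-injective P d
... | input a , P' , d' , refl , refl = _ , t-parˡ d' , extrude-boundˡ P' Q
extrude-≼ {P} (t-newIn (t-parʳ {Q' = Q'} d)) = _ , t-parʳ (t-newIn d) , extrude-boundʳ P Q'
extrude-≼ {P} (t-open (t-parˡ d)) with step-ren⁻ suc-injective P d
... | freeOut a b , P' , d' , () , _
extrude-≼ (t-open (t-parʳ d)) = _ , t-parʳ (t-open d) , ≈-refl

extrude-≼⁻ : ∀ {P Q} → (P ∣ new Q) ≼ new (shift P ∣ Q)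
extrude-≼⁻ {α = τ} (t-parˡ d) = _ , t-newτ (t-parˡ (step-ren suc d)) , ≈-sym ≈-extrude
extrude-≼⁻ {α = freeOut a b} (t-parˡ d) = _ , t-newOut (t-parˡ (step-ren suc d)) , ≈-sym ≈-extrude
extrude-≼⁻ {Q = Q} {α = boundOut a} (t-parˡ {P' = P'} d) =
  _ , t-newBoundOut (t-parˡ (step-ren suc d)) , ≈-sym (extrude-boundˡ P' Q)
extrude-≼⁻ {Q = Q} {α = input a} (t-parˡ {P' = P'} d) =
  _ , t-newIn (t-parˡ (step-ren suc d)) , ≈-sym (extrude-boundˡ P' Q)
extrude-≼⁻ (t-parʳ (t-newτ e)) = _ , t-newτ (t-parʳ e) , ≈-sym ≈-extrude
extrude-≼⁻ (t-parʳ (t-newOut e)) = _ , t-newOut (t-parʳ e) , ≈-sym ≈-extrude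
extrude-≼⁻ {P} (t-parʳ (t-newBoundOut {P' = Q'} e)) = _ , t-newBoundOut (t-parʳ e) , ≈-sym (extrude-boundʳ P Q')
extrude-≼⁻ {P} (t-parʳ (t-newIn {P' = Q'} e)) = _ , t-newIn (t-parʳ e) , ≈-sym (extrude-boundʳ P Q')
extrude-≼⁻ (t-parʳ (t-open e)) = _ , t-open (t-parʳ e) , ≈-refl
extrude-≼⁻ (t-commˡ {P' = P'} {b = b} d (t-newIn {P' = Q'} e)) =
  _ , t-newτ (t-commˡ (step-ren suc d) e) ,
  ≈-sym (≡→≈ (cong (λ R → new (shift P' ∣ R)) (sym (ren-fuse Q' (lift-sub₀-swap b)))) ⟫ ≈-extrude)
extrude-≼⁻ (t-commʳ {P' = P'} {b = b} d (t-newOut {P' = Q'} e)) =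
  _ , t-newτ (t-commʳ (step-ren suc d) e) ,
  ≈-sym (≡→≈ (cong (λ R → new (R ∣ Q')) (ren-square P' (sub₀-suc-lift-suc b))) ⟫ ≈-extrude)
extrude-≼⁻ (t-closeˡ {P' = P'} d (t-newIn {P' = Q'} e)) = _ , t-newτ (t-closeˡ (step-ren suc d) e) , new-pullʳ P' Q'
extrude-≼⁻ (t-closeʳ {P' = P'} d (t-open {P' = Q'} e)) =
  _ , t-newτ (t-commʳ (step-ren suc d) e) ,
  ≈-sym (≡→≈ (cong (λ R → new (R ∣ Q')) (ren-cancel P' sub₀-zero-lift-suc)))
extrude-≼⁻ (t-closeʳ {P' = P'} d (t-newBoundOut {P' = Q'} e)) =
  _ , t-newτ (t-closeʳ (step-ren suc d) e) , new-pullʳ P' Q'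

≈-bisimilar : ∀ {P Q} → P ≈ Q → (P ≼ Q) × (Q ≼ P)
≈-bisimilar ≈-refl = ≼-refl , ≼-refl
≈-bisimilar (≈-sym P≈Q) with ≈-bisimilar P≈Q
... | P≼Q , Q≼P = Q≼P , P≼Q
≈-bisimilar (≈-trans P≈Q Q≈R) with ≈-bisimilar P≈Q | ≈-bisimilar Q≈R
... | P≼Q , Q≼P | Q≼R , R≼Q = ≼-trans P≼Q Q≼R , ≼-trans R≼Q Q≼P
≈-bisimilar (≈-send P≈Q) = ≼-send P≈Q , ≼-send (≈-sym P≈Q)
≈-bisimilar (≈-recv P≈Q) = ≼-recv P≈Q , ≼-recv (≈-sym P≈Q)
≈-bisimilar (≈-par P≈P′ Q≈Q′) with ≈-bisimilar P≈P′ | ≈-bisimilar Q≈Q′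
... | P≼P′ , P′≼P | Q≼Q′ , Q′≼Q =
  ≼-par P≼P′ Q≼Q′ P≈P′ Q≈Q′ , ≼-par P′≼P Q′≼Q (≈-sym P≈P′) (≈-sym Q≈Q′)
≈-bisimilar (≈-new P≈Q) with ≈-bisimilar P≈Q
... | P≼Q , Q≼P = ≼-new P≼Q , ≼-new Q≼P
≈-bisimilar (≈-rep P≈Q) with ≈-bisimilar P≈Q
... | P≼Q , Q≼P = ≼-rep P≼Q P≈Q , ≼-rep Q≼P (≈-sym P≈Q)
≈-bisimilar ≈-assoc = assoc-≼ , assoc-≼⁻
≈-bisimilar ≈-comm = comm-≼ , comm-≼
≈-bisimilar ≈-nil = nil-≼ , nil-≼⁻
≈-bisimilar ≈-unfold = unfold-≼ , unfold-≼⁻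
≈-bisimilar ≈-newNil = newNil-≼ , newNil-≼⁻
≈-bisimilar ≈-newSwap = newSwap-≼ , newSwap-≼⁻
≈-bisimilar ≈-extrude = extrude-≼ , extrude-≼⁻

≈⇒≼ : ∀ {P Q} → P ≈ Q → P ≼ Q
≈⇒≼ = proj₁ ∘ ≈-bisimilar


-- Boudol's encoding and its handshake

suc² : ℕ → ℕ
suc² n = suc (suc n)

-- x̄z.P ↦ (u)(x̄u | u(v).(v̄z | P)) and x(y).P ↦ x(u).(v)(ūv | v(y).P).
encode : Tm → Tm
encode nil = nil
encode (send a b P) = new (send (suc a) zero nil ∣ recv zero (send zero (suc² b) nil ∣ ren suc² (encode P)))
encode (recv a P) = recv a (new (send (suc zero) zero nil ∣ recv zero (ren (lift suc²) (encode P))))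
encode (P ∣ Q) = encode P ∣ encode Q
encode (new P) = new (encode P)
encode (rep P) = rep (encode P)

lift²-suc² : ∀ f → (lift (lift f) ∘ suc²) ≗ (suc² ∘ f)
lift²-suc² f n = refl

lift³-suc² : ∀ f → (lift (lift (lift f)) ∘ lift suc²) ≗ (lift suc² ∘ lift f)
lift³-suc² f zero = refl
lift³-suc² f (suc n) = refl

ren-suc² : ∀ P → ren suc² P ≡ shift (shift P)
ren-suc² P = sym (ren-fuse P (λ _ → refl))

encode-ren : ∀ f P → ren f (encode P) ≡ encode (ren f P)
encode-ren f nil = refl
encode-ren f (send a b P) = cong (λ R → new (send _ zero nil ∣ recv zero (send zero _ nil ∣ R)))
  (trans (ren-square (encode P) (lift²-suc² f)) (cong (ren suc²) (encode-ren f P)))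
encode-ren f (recv a P) = cong (λ R → recv _ (new (send (suc zero) zero nil ∣ recv zero R)))
  (trans (ren-square (encode P) (lift³-suc² f)) (cong (ren (lift suc²)) (encode-ren (lift f) P)))
encode-ren f (P ∣ Q) = cong₂ _∣_ (encode-ren f P) (encode-ren f Q)
encode-ren f (new P) = cong new (encode-ren (lift f) P)
encode-ren f (rep P) = cong rep (encode-ren f P)

-- States of the handshake between the encodings of x̄z.P (z at index b) and x(y).Q once
-- the receiver has taken the private u: in ackPending it has yet to send v on u; after
-- that (ackPending′ ≈ encode P ∣ dataPending) only z has to travel on v, and once it has
-- (dataPending′) what is left is the encoding of Q{z/y}.
awaitingAck : ℕ → Tm → Tm
awaitingAck b P = nil ∣ recv zero (send zero (suc² b) nil ∣ ren suc² (encode P))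

offeringAck : Tm → Tm
offeringAck Q = new (send (suc zero) zero nil ∣ recv zero (ren (lift suc²) (encode Q)))

ackPending : ℕ → Tm → Tm → Tm
ackPending b P Q = new (awaitingAck b P ∣ offeringAck Q)

ackPending′ : ℕ → Tm → Tm → Tm
ackPending′ b P Q =
  new (new ((nil ∣ (send zero (suc² b) nil ∣ ren suc² (encode P)))
            ∣ (nil ∣ recv zero (ren (lift suc²) (encode Q)))))

dataPending : ℕ → Tm → Tm
dataPending b Q = new (new (send zero (suc² b) nil ∣ recv zero (ren (lift suc²) (encode Q))))

dataPending′ : ℕ → Tm → Tm
dataPending′ b Q = new (new (nil ∣ ren (sub₀ (suc² b)) (ren (lift suc²) (encode Q))))

awaitingAck-ren : ∀ f b P → ren (lift f) (awaitingAck b P) ≡ awaitingAck (f b) (ren f P)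
awaitingAck-ren f b P = cong (λ R → nil ∣ recv zero (send zero _ nil ∣ R))
  (trans (ren-square (encode P) (lift²-suc² f)) (cong (ren suc²) (encode-ren f P)))

offeringAck-ren : ∀ f Q → ren (lift f) (offeringAck Q) ≡ offeringAck (ren (lift f) Q)
offeringAck-ren f Q = cong (λ R → new (send (suc zero) zero nil ∣ recv zero R))
  (trans (ren-square (encode Q) (lift³-suc² f)) (cong (ren (lift suc²)) (encode-ren (lift f) Q)))

dataPending-ren : ∀ f b Q → ren f (dataPending b Q) ≡ dataPending (f b) (ren (lift f) Q)
dataPending-ren f b Q = cong (λ R → new (new (send zero _ nil ∣ recv zero R)))
  (trans (ren-square (encode Q) (lift³-suc² f)) (cong (ren (lift suc²)) (encode-ren (lift f) Q)))

ackPending-step : ∀ {b P Q} → ackPending b P Q -[ τ ]→ ackPending′ b P Q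
ackPending-step = t-newτ (t-closeʳ (t-parʳ t-recv) (t-open (t-parˡ t-send)))

ackPending′-≈ : ∀ b P Q → ackPending′ b P Q ≈ (encode P ∣ dataPending b Q)
ackPending′-≈ b P Q =
  ≈-new (≈-new (≈-par nil-∣ nil-∣ ⟫ ≈-par ≈-comm ≈-refl ⟫ ≈-sym ≈-assoc
                ⟫ ≡→≈ (cong (_∣ _) (ren-suc² (encode P)))))
  ⟫ ≈-new ≈-extrude ⟫ ≈-extrude

dataPending-step : ∀ {b Q} → dataPending b Q -[ τ ]→ dataPending′ b Q
dataPending-step = t-newτ (t-newτ (t-commˡ t-send t-recv))

sub₀-suc²-lift-suc² : ∀ b → (sub₀ (suc² b) ∘ lift suc²) ≗ (suc² ∘ sub₀ b)
sub₀-suc²-lift-suc² b zero = refl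
sub₀-suc²-lift-suc² b (suc n) = refl

dataPending′-≈ : ∀ b Q → dataPending′ b Q ≈ encode (ren (sub₀ b) Q)
dataPending′-≈ b Q = ≈-new (≈-new (nil-∣ ⟫ ≡→≈ instantiated)) ⟫ ≈-new new-shift ⟫ new-shift
  where
  instantiated : ren (sub₀ (suc² b)) (ren (lift suc²) (encode Q)) ≡ shift (shift (encode (ren (sub₀ b) Q)))
  instantiated = begin
    ren (sub₀ (suc² b)) (ren (lift suc²) (encode Q)) ≡⟨ ren-square (encode Q) (sub₀-suc²-lift-suc² b) ⟩
    ren suc² (ren (sub₀ b) (encode Q))               ≡⟨ cong (ren suc²) (encode-ren (sub₀ b) Q) ⟩
    ren suc² (encode (ren (sub₀ b) Q))               ≡⟨ ren-suc² _ ⟩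
    shift (shift (encode (ren (sub₀ b) Q)))          ∎
    where open ≡-Reasoning

nil∣recv-inv : ∀ {c K α X} → (nil ∣ recv c K) -[ α ]→ X → (α ≡ input c) × (X ≡ (nil ∣ K))
nil∣recv-inv (t-parˡ ())
nil∣recv-inv (t-parʳ t-recv) = refl , refl
nil∣recv-inv (t-commˡ () _)
nil∣recv-inv (t-commʳ () _)
nil∣recv-inv (t-closeˡ () _)
nil∣recv-inv (t-closeʳ () _)

offeringAck-inv : ∀ {Q α X} → offeringAck Q -[ α ]→ X →
                  (α ≡ boundOut zero) × (X ≡ (nil ∣ recv zero (ren (lift suc²) (encode Q))))
offeringAck-inv (t-newτ (t-parˡ ()))
offeringAck-inv (t-newτ (t-parʳ ()))
offeringAck-inv (t-newτ (t-commˡ t-send ()))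
offeringAck-inv (t-newτ (t-commʳ () _))
offeringAck-inv (t-newτ (t-closeˡ () _))
offeringAck-inv (t-newτ (t-closeʳ () _))
offeringAck-inv (t-newOut (t-parˡ ()))
offeringAck-inv (t-newOut (t-parʳ ()))
offeringAck-inv (t-newBoundOut (t-parˡ ()))
offeringAck-inv (t-newBoundOut (t-parʳ ()))
offeringAck-inv (t-newIn (t-parˡ ()))
offeringAck-inv (t-newIn (t-parʳ ()))
offeringAck-inv (t-open (t-parˡ t-send)) = refl , refl
offeringAck-inv (t-open (t-parʳ ()))

ackPending-inv : ∀ {b P Q α X} → ackPending b P Q -[ α ]→ X → (α ≡ τ) × (X ≡ ackPending′ b P Q)
ackPending-inv (t-newτ (t-closeʳ d e)) with nil∣recv-inv d | offeringAck-inv e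
... | refl , refl | refl , refl = refl , refl
ackPending-inv (t-newτ (t-parˡ d)) with () ← proj₁ (nil∣recv-inv d)
ackPending-inv (t-newτ (t-parʳ d)) with () ← proj₁ (offeringAck-inv d)
ackPending-inv (t-newτ (t-commˡ d e)) with () ← proj₁ (nil∣recv-inv d)
ackPending-inv (t-newτ (t-commʳ d e)) with () ← proj₁ (offeringAck-inv e)
ackPending-inv (t-newτ (t-closeˡ d e)) with () ← proj₁ (nil∣recv-inv d)
ackPending-inv (t-newOut (t-parˡ d)) with () ← proj₁ (nil∣recv-inv d)
ackPending-inv (t-newOut (t-parʳ d)) with () ← proj₁ (offeringAck-inv d)
ackPending-inv (t-newBoundOut (t-parˡ d)) with () ← proj₁ (nil∣recv-inv d)
ackPending-inv (t-newBoundOut (t-parʳ d)) with () ← proj₁ (offeringAck-inv d)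
ackPending-inv (t-newIn (t-parˡ d)) with () ← proj₁ (nil∣recv-inv d)
ackPending-inv (t-newIn (t-parʳ d)) with () ← proj₁ (offeringAck-inv d)
ackPending-inv (t-open (t-parˡ d)) with () ← proj₁ (nil∣recv-inv d)
ackPending-inv (t-open (t-parʳ d)) with () ← proj₁ (offeringAck-inv d)

dataPending-inv : ∀ {b Q α X} → dataPending b Q -[ α ]→ X → (α ≡ τ) × (X ≡ dataPending′ b Q)
dataPending-inv (t-newτ (t-newτ (t-commˡ t-send t-recv))) = refl , refl
dataPending-inv (t-newτ (t-newτ (t-parˡ ())))
dataPending-inv (t-newτ (t-newτ (t-parʳ ())))
dataPending-inv (t-newτ (t-newτ (t-commʳ () _)))
dataPending-inv (t-newτ (t-newτ (t-closeˡ () _)))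
dataPending-inv (t-newτ (t-newτ (t-closeʳ () _)))
dataPending-inv (t-newOut (t-newOut (t-parˡ ())))
dataPending-inv (t-newOut (t-newOut (t-parʳ ())))
dataPending-inv (t-newBoundOut (t-newBoundOut (t-parˡ ())))
dataPending-inv (t-newBoundOut (t-newBoundOut (t-parʳ ())))
dataPending-inv (t-newBoundOut (t-open (t-parˡ ())))
dataPending-inv (t-newBoundOut (t-open (t-parʳ ())))
dataPending-inv (t-newIn (t-newIn (t-parˡ ())))
dataPending-inv (t-newIn (t-newIn (t-parʳ ())))
dataPending-inv (t-open (t-newOut (t-parˡ ())))
dataPending-inv (t-open (t-newOut (t-parʳ ())))

-- Encodes X Y: X is the encoding of Y, except that some communications of Y may
-- already have been performed, with X still in the middle of their handshakes.
data Encodes : Tm → Tm → Set where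
  enc-nil         : Encodes nil nil
  enc-send        : ∀ {a b P} → Encodes (encode (send a b P)) (send a b P)
  enc-recv        : ∀ {a P} → Encodes (encode (recv a P)) (recv a P)
  enc-par         : ∀ {X₁ Y₁ X₂ Y₂} → Encodes X₁ Y₁ → Encodes X₂ Y₂ → Encodes (X₁ ∣ X₂) (Y₁ ∣ Y₂)
  enc-new         : ∀ {X Y} → Encodes X Y → Encodes (new X) (new Y)
  enc-rep         : ∀ {P} → Encodes (rep (encode P)) (rep P)
  enc-ackPending  : ∀ {b P Q} → Encodes (ackPending b P Q) (P ∣ ren (sub₀ b) Q)
  enc-dataPending : ∀ {b Q} → Encodes (dataPending b Q) (ren (sub₀ b) Q)

encodes-encode : ∀ Y → Encodes (encode Y) Y
encodes-encode nil = enc-nil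
encodes-encode (send a b P) = enc-send
encodes-encode (recv a P) = enc-recv
encodes-encode (P ∣ Q) = enc-par (encodes-encode P) (encodes-encode Q)
encodes-encode (new P) = enc-new (encodes-encode P)
encodes-encode (rep P) = enc-rep

encodes-≡ : ∀ {X X' Y Y'} → X ≡ X' → Y ≡ Y' → Encodes X Y → Encodes X' Y'
encodes-≡ refl refl enc = enc

encodes-ren : ∀ f {X Y} → Encodes X Y → Encodes (ren f X) (ren f Y)
encodes-ren f enc-nil = enc-nil
encodes-ren f (enc-send {a} {b} {P}) = encodes-≡ (sym (encode-ren f (send a b P))) refl enc-send
encodes-ren f (enc-recv {a} {P}) = encodes-≡ (sym (encode-ren f (recv a P))) refl enc-recv
encodes-ren f (enc-par enc₁ enc₂) = enc-par (encodes-ren f enc₁) (encodes-ren f enc₂)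
encodes-ren f (enc-new enc) = enc-new (encodes-ren (lift f) enc)
encodes-ren f (enc-rep {P}) = encodes-≡ (sym (cong rep (encode-ren f P))) refl enc-rep
encodes-ren f (enc-ackPending {b} {P} {Q}) =
  encodes-≡ (sym (cong new (cong₂ _∣_ (awaitingAck-ren f b P) (offeringAck-ren f Q))))
            (cong (ren f P ∣_) (sym (ren-square Q (sub₀-natural f b))))
            enc-ackPending
encodes-ren f (enc-dataPending {b} {Q}) =
  encodes-≡ (sym (dataPending-ren f b Q)) (sym (ren-square Q (sub₀-natural f b))) enc-dataPending

-- Derivatives of an encoding of Y after the first visible step of a handshake: the bound
-- output of u, matching a free output of b (EncodesAfterOut b) or a bound output
-- (EncodesAfterBoundOut) by Y, and the input of u, matching an input by Y (EncodesAfterIn).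
data EncodesAfterOut : ℕ → Tm → Tm → Set where
  eo-base : ∀ {b P} → EncodesAfterOut b (awaitingAck b P) P
  eo-parˡ : ∀ {b X Y X₂ Y₂} → EncodesAfterOut b X Y → Encodes X₂ Y₂ →
            EncodesAfterOut b (X ∣ shift X₂) (Y ∣ Y₂)
  eo-parʳ : ∀ {b X Y X₁ Y₁} → Encodes X₁ Y₁ → EncodesAfterOut b X Y →
            EncodesAfterOut b (shift X₁ ∣ X) (Y₁ ∣ Y)
  eo-new  : ∀ {b X Y} → EncodesAfterOut (suc b) X Y → EncodesAfterOut b (new (ren swap X)) (new Y)

data EncodesAfterBoundOut : Tm → Tm → Set where
  ebo-open : ∀ {X Y} → EncodesAfterOut zero X Y → EncodesAfterBoundOut (new (ren swap X)) Y
  ebo-parˡ : ∀ {X Y X₂ Y₂} → EncodesAfterBoundOut X Y → Encodes X₂ Y₂ →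
             EncodesAfterBoundOut (X ∣ shift X₂) (Y ∣ shift Y₂)
  ebo-parʳ : ∀ {X Y X₁ Y₁} → Encodes X₁ Y₁ → EncodesAfterBoundOut X Y →
             EncodesAfterBoundOut (shift X₁ ∣ X) (shift Y₁ ∣ Y)
  ebo-new  : ∀ {X Y} → EncodesAfterBoundOut X Y → EncodesAfterBoundOut (new (ren swap X)) (new (ren swap Y))

data EncodesAfterIn : Tm → Tm → Set where
  ei-base : ∀ {Q} → EncodesAfterIn (offeringAck Q) Q
  ei-parˡ : ∀ {X Y X₂ Y₂} → EncodesAfterIn X Y → Encodes X₂ Y₂ →
            EncodesAfterIn (X ∣ shift X₂) (Y ∣ shift Y₂)
  ei-parʳ : ∀ {X Y X₁ Y₁} → Encodes X₁ Y₁ → EncodesAfterIn X Y →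
            EncodesAfterIn (shift X₁ ∣ X) (shift Y₁ ∣ Y)
  ei-new  : ∀ {X Y} → EncodesAfterIn X Y → EncodesAfterIn (new (ren swap X)) (new (ren swap Y))

encodesAfterIn-≡ : ∀ {X X' Y Y'} → X ≡ X' → Y ≡ Y' → EncodesAfterIn X Y → EncodesAfterIn X' Y'
encodesAfterIn-≡ refl refl enc = enc

encodesAfterIn-ren : ∀ f {X Y} → EncodesAfterIn X Y → EncodesAfterIn (ren (lift f) X) (ren (lift f) Y)
encodesAfterIn-ren f (ei-base {Q}) = encodesAfterIn-≡ (sym (offeringAck-ren f Q)) refl ei-base
encodesAfterIn-ren f (ei-parˡ {X₂ = X₂} {Y₂ = Y₂} enc enc₂) =
  encodesAfterIn-≡ (cong (_ ∣_) (sym (lift-shift f X₂))) (cong (_ ∣_) (sym (lift-shift f Y₂)))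
                   (ei-parˡ (encodesAfterIn-ren f enc) (encodes-ren f enc₂))
encodesAfterIn-ren f (ei-parʳ {X₁ = X₁} {Y₁ = Y₁} enc₁ enc) =
  encodesAfterIn-≡ (cong (_∣ _) (sym (lift-shift f X₁))) (cong (_∣ _) (sym (lift-shift f Y₁)))
                   (ei-parʳ (encodes-ren f enc₁) (encodesAfterIn-ren f enc))
encodesAfterIn-ren f (ei-new {X} {Y} enc) =
  encodesAfterIn-≡ (cong new (ren-square X (swap-natural f))) (cong new (ren-square Y (swap-natural f)))
                   (ei-new (encodesAfterIn-ren (lift f) enc))

Encodes≈ : Tm → Tm → Set
Encodes≈ X Y = Σ Tm λ X₀ → Σ Tm λ Y₀ → (X ≈ X₀) × Encodes X₀ Y₀ × (Y₀ ≈ Y)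

encodes≈-intro : ∀ {X Y} → Encodes X Y → Encodes≈ X Y
encodes≈-intro enc = _ , _ , ≈-refl , enc , ≈-refl

encodes≈-resp : ∀ {X X' Y Y'} → X' ≈ X → Encodes≈ X Y → Y ≈ Y' → Encodes≈ X' Y'
encodes≈-resp X'≈X (X₀ , Y₀ , X≈X₀ , enc , Y₀≈Y) Y≈Y' = X₀ , Y₀ , X'≈X ⟫ X≈X₀ , enc , Y₀≈Y ⟫ Y≈Y'

encodes≈-parˡ : ∀ {X₁ Y₁ X₂ Y₂} → Encodes≈ X₁ Y₁ → Encodes X₂ Y₂ → Encodes≈ (X₁ ∣ X₂) (Y₁ ∣ Y₂)
encodes≈-parˡ (_ , _ , X≈ , enc , ≈Y) enc₂ = _ , _ , ≈-par X≈ ≈-refl , enc-par enc enc₂ , ≈-par ≈Y ≈-refl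

encodes≈-parʳ : ∀ {X₁ Y₁ X₂ Y₂} → Encodes X₁ Y₁ → Encodes≈ X₂ Y₂ → Encodes≈ (X₁ ∣ X₂) (Y₁ ∣ Y₂)
encodes≈-parʳ enc₁ (_ , _ , X≈ , enc , ≈Y) = _ , _ , ≈-par ≈-refl X≈ , enc-par enc₁ enc , ≈-par ≈-refl ≈Y

encodes≈-new : ∀ {X Y} → Encodes≈ X Y → Encodes≈ (new X) (new Y)
encodes≈-new (_ , _ , X≈ , enc , ≈Y) = _ , _ , ≈-new X≈ , enc-new enc , ≈-new ≈Y

close-awaitingAck : ∀ {X Y} b P → EncodesAfterIn X Y →
                    Encodes≈ (new (awaitingAck b P ∣ X)) (P ∣ ren (sub₀ b) Y)
close-awaitingAck b P ei-base = encodes≈-intro enc-ackPending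
close-awaitingAck b P (ei-parˡ {Y₂ = Y₂} enc enc₂) =
  encodes≈-resp extrude-last (encodes≈-parˡ (close-awaitingAck b P enc) enc₂)
    (≈-sym ≈-assoc ⟫ ≈-par ≈-refl (≈-par ≈-refl (≡→≈ (sym (sub₀-shift b Y₂)))))
close-awaitingAck b P (ei-parʳ {Y₁ = Y₁} enc₁ enc) =
  encodes≈-resp (≈-new (≈-par ≈-refl ≈-comm) ⟫ extrude-last) (encodes≈-parˡ (close-awaitingAck b P enc) enc₁)
    (≈-sym ≈-assoc ⟫ ≈-par ≈-refl (≈-comm ⟫ ≈-par (≡→≈ (sym (sub₀-shift b Y₁))) ≈-refl))
close-awaitingAck b P (ei-new {X} {Y} enc) =
  encodes≈-resp
    (new-pullʳ (awaitingAck b P) X ⟫ ≡→≈ (cong (λ R → new (new (R ∣ X))) (awaitingAck-ren suc b P)))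
    (encodes≈-new (close-awaitingAck (suc b) (shift P) enc))
    (≈-extrude ⟫ ≈-par ≈-refl (≡→≈ (cong new (sym (ren-fuse Y (lift-sub₀-swap b))))))

close-afterOut : ∀ {b X₁ Y₁ X₂ Y₂} → EncodesAfterOut b X₁ Y₁ → EncodesAfterIn X₂ Y₂ →
                 Encodes≈ (new (X₁ ∣ X₂)) (Y₁ ∣ ren (sub₀ b) Y₂)
close-afterOut {b} (eo-base {P = P}) encIn = close-awaitingAck b P encIn
close-afterOut (eo-parˡ encOut enc) encIn =
  encodes≈-resp extrude-middleˡ (encodes≈-parˡ (close-afterOut encOut encIn) enc)
    (≈-sym ≈-assoc ⟫ ≈-par ≈-refl ≈-comm ⟫ ≈-assoc)
close-afterOut (eo-parʳ enc encOut) encIn =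
  encodes≈-resp extrude-first (encodes≈-parʳ enc (close-afterOut encOut encIn)) ≈-assoc
close-afterOut {b} {X₂ = X₂} {Y₂ = Y₂} (eo-new {X = X} encOut) encIn =
  encodes≈-resp (new-pullˡ X X₂) (encodes≈-new (close-afterOut encOut (encodesAfterIn-ren suc encIn)))
    (≈-new (≈-par ≈-refl (≡→≈ (ren-square Y₂ (sub₀-suc-lift-suc b))) ⟫ ≈-comm) ⟫ ≈-extrude ⟫ ≈-comm)

close-afterBoundOut : ∀ {X₁ Y₁ X₂ Y₂} → EncodesAfterBoundOut X₁ Y₁ → EncodesAfterIn X₂ Y₂ →
                      Encodes≈ (new (X₁ ∣ X₂)) (new (Y₁ ∣ Y₂))
close-afterBoundOut {X₂ = X₂} {Y₂ = Y₂} (ebo-open {X} encOut) encIn =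
  encodes≈-resp (new-pullˡ X X₂) (encodes≈-new (close-afterOut encOut (encodesAfterIn-ren suc encIn)))
    (≈-new (≈-par ≈-refl (≡→≈ (ren-cancel Y₂ sub₀-zero-lift-suc))))
close-afterBoundOut (ebo-parˡ encOut enc) encIn =
  encodes≈-resp extrude-middleˡ (encodes≈-parˡ (close-afterBoundOut encOut encIn) enc) (≈-sym extrude-middleˡ)
close-afterBoundOut (ebo-parʳ enc encOut) encIn =
  encodes≈-resp extrude-first (encodes≈-parʳ enc (close-afterBoundOut encOut encIn)) (≈-sym extrude-first)
close-afterBoundOut {X₂ = X₂} {Y₂ = Y₂} (ebo-new {X} {Y} encOut) encIn =
  encodes≈-resp (new-pullˡ X X₂) (encodes≈-new (close-afterBoundOut encOut (encodesAfterIn-ren suc encIn)))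
    (≈-sym (new-pullˡ Y Y₂))

-- Transitions of encodings

encodes-no-freeOut : ∀ {X Y a b X'} → Encodes X Y → X -[ freeOut a b ]→ X' → ⊥
encodes-no-freeOut enc-nil ()
encodes-no-freeOut enc-send (t-newOut (t-parˡ ()))
encodes-no-freeOut enc-send (t-newOut (t-parʳ ()))
encodes-no-freeOut enc-recv ()
encodes-no-freeOut (enc-par enc₁ enc₂) (t-parˡ d) = encodes-no-freeOut enc₁ d
encodes-no-freeOut (enc-par enc₁ enc₂) (t-parʳ d) = encodes-no-freeOut enc₂ d
encodes-no-freeOut (enc-new enc) (t-newOut d) = encodes-no-freeOut enc d
encodes-no-freeOut (enc-rep {P}) (t-rep d) = encodes-no-freeOut (enc-par (encodes-encode P) enc-rep) d
encodes-no-freeOut enc-ackPending d with () ← proj₁ (ackPending-inv d)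
encodes-no-freeOut enc-dataPending d with () ← proj₁ (dataPending-inv d)

data BoundOutMatch (Y : Tm) (a : ℕ) (X' : Tm) : Set where
  byFreeOut  : ∀ {b Y'} → Y -[ freeOut a b ]→ Y' → EncodesAfterOut b X' Y' → BoundOutMatch Y a X'
  byBoundOut : ∀ {Y'} → Y -[ boundOut a ]→ Y' → EncodesAfterBoundOut X' Y' → BoundOutMatch Y a X'

encodes-boundOut : ∀ {X Y a X'} → Encodes X Y → X -[ boundOut a ]→ X' → BoundOutMatch Y a X'
encodes-boundOut enc-nil ()
encodes-boundOut enc-send (t-open (t-parˡ t-send)) = byFreeOut t-send eo-base
encodes-boundOut enc-send (t-open (t-parʳ ()))
encodes-boundOut enc-send (t-newBoundOut (t-parˡ ()))
encodes-boundOut enc-send (t-newBoundOut (t-parʳ ()))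
encodes-boundOut enc-recv ()
encodes-boundOut (enc-par enc₁ enc₂) (t-parˡ d) with encodes-boundOut enc₁ d
... | byFreeOut e encOut = byFreeOut (t-parˡ e) (eo-parˡ encOut enc₂)
... | byBoundOut e encOut = byBoundOut (t-parˡ e) (ebo-parˡ encOut enc₂)
encodes-boundOut (enc-par enc₁ enc₂) (t-parʳ d) with encodes-boundOut enc₂ d
... | byFreeOut e encOut = byFreeOut (t-parʳ e) (eo-parʳ enc₁ encOut)
... | byBoundOut e encOut = byBoundOut (t-parʳ e) (ebo-parʳ enc₁ encOut)
encodes-boundOut (enc-new enc) (t-newBoundOut d) with encodes-boundOut enc d
... | byFreeOut {b = zero} e encOut = byBoundOut (t-open e) (ebo-open encOut)
... | byFreeOut {b = suc b} e encOut = byFreeOut (t-newOut e) (eo-new encOut)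
... | byBoundOut e encOut = byBoundOut (t-newBoundOut e) (ebo-new encOut)
encodes-boundOut (enc-new enc) (t-open d) = ⊥-elim (encodes-no-freeOut enc d)
encodes-boundOut (enc-rep {P}) (t-rep d) with encodes-boundOut (enc-par (encodes-encode P) enc-rep) d
... | byFreeOut e encOut = byFreeOut (t-rep e) encOut
... | byBoundOut e encOut = byBoundOut (t-rep e) encOut
encodes-boundOut enc-ackPending d with () ← proj₁ (ackPending-inv d)
encodes-boundOut enc-dataPending d with () ← proj₁ (dataPending-inv d)

encodes-input : ∀ {X Y a X'} → Encodes X Y → X -[ input a ]→ X' →
                Σ Tm λ Y' → (Y -[ input a ]→ Y') × EncodesAfterIn X' Y'
encodes-input enc-nil ()
encodes-input enc-send (t-newIn (t-parˡ ()))
encodes-input enc-send (t-newIn (t-parʳ ()))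
encodes-input (enc-recv {a} {P}) t-recv = P , t-recv , ei-base
encodes-input (enc-par enc₁ enc₂) (t-parˡ d) with encodes-input enc₁ d
... | _ , e , encIn = _ , t-parˡ e , ei-parˡ encIn enc₂
encodes-input (enc-par enc₁ enc₂) (t-parʳ d) with encodes-input enc₂ d
... | _ , e , encIn = _ , t-parʳ e , ei-parʳ enc₁ encIn
encodes-input (enc-new enc) (t-newIn d) with encodes-input enc d
... | _ , e , encIn = _ , t-newIn e , ei-new encIn
encodes-input (enc-rep {P}) (t-rep d) with encodes-input (enc-par (encodes-encode P) enc-rep) d
... | _ , e , encIn = _ , t-rep e , encIn
encodes-input enc-ackPending d with () ← proj₁ (ackPending-inv d)
encodes-input enc-dataPending d with () ← proj₁ (dataPending-inv d)

data τAnswer (Y X' : Tm) : Set where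
  idle   : Encodes≈ X' Y → τAnswer Y X'
  follow : ∀ {Y'} → Y -[ τ ]→ Y' → Encodes≈ X' Y' → τAnswer Y X'

encodes-τ : ∀ {X Y X'} → Encodes X Y → X -[ τ ]→ X' → τAnswer Y X'
encodes-τ enc-nil ()
encodes-τ enc-send (t-newτ (t-parˡ ()))
encodes-τ enc-send (t-newτ (t-parʳ ()))
encodes-τ enc-send (t-newτ (t-commˡ t-send ()))
encodes-τ enc-send (t-newτ (t-commʳ () _))
encodes-τ enc-send (t-newτ (t-closeˡ () _))
encodes-τ enc-send (t-newτ (t-closeʳ () _))
encodes-τ enc-recv ()
encodes-τ (enc-par enc₁ enc₂) (t-parˡ d) with encodes-τ enc₁ d
... | idle r = idle (encodes≈-parˡ r enc₂)
... | follow e r = follow (t-parˡ e) (encodes≈-parˡ r enc₂)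
encodes-τ (enc-par enc₁ enc₂) (t-parʳ d) with encodes-τ enc₂ d
... | idle r = idle (encodes≈-parʳ enc₁ r)
... | follow e r = follow (t-parʳ e) (encodes≈-parʳ enc₁ r)
encodes-τ (enc-par enc₁ enc₂) (t-commˡ d e) = ⊥-elim (encodes-no-freeOut enc₁ d)
encodes-τ (enc-par enc₁ enc₂) (t-commʳ d e) = ⊥-elim (encodes-no-freeOut enc₂ e)
encodes-τ (enc-par enc₁ enc₂) (t-closeˡ d e) with encodes-boundOut enc₁ d | encodes-input enc₂ e
... | byFreeOut d' encOut | _ , e' , encIn = follow (t-commˡ d' e') (close-afterOut encOut encIn)
... | byBoundOut d' encOut | _ , e' , encIn = follow (t-closeˡ d' e') (close-afterBoundOut encOut encIn)
encodes-τ (enc-par enc₁ enc₂) (t-closeʳ d e) with encodes-input enc₁ d | encodes-boundOut enc₂ e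
... | _ , d' , encIn | byFreeOut e' encOut =
  follow (t-commʳ d' e') (encodes≈-resp (≈-new ≈-comm) (close-afterOut encOut encIn) ≈-comm)
... | _ , d' , encIn | byBoundOut e' encOut =
  follow (t-closeʳ d' e') (encodes≈-resp (≈-new ≈-comm) (close-afterBoundOut encOut encIn) (≈-new ≈-comm))
encodes-τ (enc-new enc) (t-newτ d) with encodes-τ enc d
... | idle r = idle (encodes≈-new r)
... | follow e r = follow (t-newτ e) (encodes≈-new r)
encodes-τ (enc-rep {P}) (t-rep d) with encodes-τ (enc-par (encodes-encode P) enc-rep) d
... | idle r = idle (encodes≈-resp ≈-refl r (≈-sym ≈-unfold))
... | follow e r = follow (t-rep e) r
encodes-τ (enc-ackPending {b} {P} {Q}) d with refl , refl ← ackPending-inv d =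
  idle (encodes≈-resp (ackPending′-≈ b P Q) (encodes≈-intro (enc-par (encodes-encode P) enc-dataPending)) ≈-refl)
encodes-τ (enc-dataPending {b} {Q}) d with refl , refl ← dataPending-inv d =
  idle (encodes≈-resp (dataPending′-≈ b Q) (encodes≈-intro (encodes-encode _)) ≈-refl)

encode-freeOut : ∀ {Y a b Y'} → Y -[ freeOut a b ]→ Y' →
                 Σ Tm λ X' → (encode Y -[ boundOut a ]→ X') × EncodesAfterOut b X' Y'
encode-freeOut t-send = _ , t-open (t-parˡ t-send) , eo-base
encode-freeOut (t-parˡ {Q = Q} d) with encode-freeOut d
... | _ , e , encOut = _ , t-parˡ e , eo-parˡ encOut (encodes-encode Q)
encode-freeOut (t-parʳ {P = P} d) with encode-freeOut d
... | _ , e , encOut = _ , t-parʳ e , eo-parʳ (encodes-encode P) encOut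
encode-freeOut (t-newOut d) with encode-freeOut d
... | _ , e , encOut = _ , t-newBoundOut e , eo-new encOut
encode-freeOut (t-rep d) with encode-freeOut d
... | _ , e , encOut = _ , t-rep e , encOut

encode-boundOut : ∀ {Y a Y'} → Y -[ boundOut a ]→ Y' →
                  Σ Tm λ X' → (encode Y -[ boundOut a ]→ X') × EncodesAfterBoundOut X' Y'
encode-boundOut (t-parˡ {Q = Q} d) with encode-boundOut d
... | _ , e , encOut = _ , t-parˡ e , ebo-parˡ encOut (encodes-encode Q)
encode-boundOut (t-parʳ {P = P} d) with encode-boundOut d
... | _ , e , encOut = _ , t-parʳ e , ebo-parʳ (encodes-encode P) encOut
encode-boundOut (t-newBoundOut d) with encode-boundOut d
... | _ , e , encOut = _ , t-newBoundOut e , ebo-new encOut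
encode-boundOut (t-open d) with encode-freeOut d
... | _ , e , encOut = _ , t-newBoundOut e , ebo-open encOut
encode-boundOut (t-rep d) with encode-boundOut d
... | _ , e , encOut = _ , t-rep e , encOut

encode-input : ∀ {Y a Y'} → Y -[ input a ]→ Y' →
               Σ Tm λ X' → (encode Y -[ input a ]→ X') × EncodesAfterIn X' Y'
encode-input t-recv = _ , t-recv , ei-base
encode-input (t-parˡ {Q = Q} d) with encode-input d
... | _ , e , encIn = _ , t-parˡ e , ei-parˡ encIn (encodes-encode Q)
encode-input (t-parʳ {P = P} d) with encode-input d
... | _ , e , encIn = _ , t-parʳ e , ei-parʳ (encodes-encode P) encIn
encode-input (t-newIn d) with encode-input d
... | _ , e , encIn = _ , t-newIn e , ei-new encIn
encode-input (t-rep d) with encode-input d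
... | _ , e , encIn = _ , t-rep e , encIn

infix 4 _⟹_
data _⟹_ : Tm → Tm → Set where
  done   : ∀ {X Y} → X ≈ Y → X ⟹ Y
  τ-step : ∀ {X X' Y} → X -[ τ ]→ X' → X' ⟹ Y → X ⟹ Y

⟹-refl : ∀ {X} → X ⟹ X
⟹-refl = done ≈-refl

⟹-≈ˡ : ∀ {X X₀ Y} → X ≈ X₀ → X₀ ⟹ Y → X ⟹ Y
⟹-≈ˡ X≈X₀ (done X₀≈Y) = done (X≈X₀ ⟫ X₀≈Y)
⟹-≈ˡ X≈X₀ (τ-step d steps) with ≈⇒≼ (≈-sym X≈X₀) d
... | _ , d' , X₀'≈X' = τ-step d' (⟹-≈ˡ (≈-sym X₀'≈X') steps)

⟹-trans : ∀ {X Y Z} → X ⟹ Y → Y ⟹ Z → X ⟹ Z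
⟹-trans (done X≈Y) steps = ⟹-≈ˡ X≈Y steps
⟹-trans (τ-step d steps₁) steps₂ = τ-step d (⟹-trans steps₁ steps₂)

⟹-parˡ : ∀ {X Y Z} → X ⟹ Y → (X ∣ Z) ⟹ (Y ∣ Z)
⟹-parˡ (done X≈Y) = done (≈-par X≈Y ≈-refl)
⟹-parˡ (τ-step d steps) = τ-step (t-parˡ d) (⟹-parˡ steps)

⟹-parʳ : ∀ {X Y Z} → X ⟹ Y → (Z ∣ X) ⟹ (Z ∣ Y)
⟹-parʳ (done X≈Y) = done (≈-par ≈-refl X≈Y)
⟹-parʳ (τ-step d steps) = τ-step (t-parʳ d) (⟹-parʳ steps)

⟹-new : ∀ {X Y} → X ⟹ Y → new X ⟹ new Y
⟹-new (done X≈Y) = done (≈-new X≈Y)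
⟹-new (τ-step d steps) = τ-step (t-newτ d) (⟹-new steps)

encodes-⟹ : ∀ {X Y} → Encodes X Y → X ⟹ encode Y
encodes-⟹ enc-nil = ⟹-refl
encodes-⟹ enc-send = ⟹-refl
encodes-⟹ enc-recv = ⟹-refl
encodes-⟹ (enc-par enc₁ enc₂) = ⟹-trans (⟹-parˡ (encodes-⟹ enc₁)) (⟹-parʳ (encodes-⟹ enc₂))
encodes-⟹ (enc-new enc) = ⟹-new (encodes-⟹ enc)
encodes-⟹ enc-rep = ⟹-refl
encodes-⟹ (enc-ackPending {b} {P} {Q}) =
  τ-step ackPending-step
    (⟹-≈ˡ (ackPending′-≈ b P Q) (⟹-parʳ (τ-step dataPending-step (done (dataPending′-≈ b Q)))))
encodes-⟹ (enc-dataPending {b} {Q}) = τ-step dataPending-step (done (dataPending′-≈ b Q))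

encode-τ : ∀ {Y Y'} → Y -[ τ ]→ Y' → Σ Tm λ X' → (encode Y ⟹ X') × Encodes≈ X' Y'
encode-τ (t-parˡ {Q = Q} d) with encode-τ d
... | _ , steps , r = _ , ⟹-parˡ steps , encodes≈-parˡ r (encodes-encode Q)
encode-τ (t-parʳ {P = P} d) with encode-τ d
... | _ , steps , r = _ , ⟹-parʳ steps , encodes≈-parʳ (encodes-encode P) r
encode-τ (t-commˡ d e) with encode-freeOut d | encode-input e
... | _ , d' , encOut | _ , e' , encIn = _ , τ-step (t-closeˡ d' e') ⟹-refl , close-afterOut encOut encIn
encode-τ (t-commʳ d e) with encode-input d | encode-freeOut e
... | _ , d' , encIn | _ , e' , encOut =
  _ , τ-step (t-closeʳ d' e') ⟹-refl , encodes≈-resp (≈-new ≈-comm) (close-afterOut encOut encIn) ≈-comm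
encode-τ (t-closeˡ d e) with encode-boundOut d | encode-input e
... | _ , d' , encOut | _ , e' , encIn = _ , τ-step (t-closeˡ d' e') ⟹-refl , close-afterBoundOut encOut encIn
encode-τ (t-closeʳ d e) with encode-input d | encode-boundOut e
... | _ , d' , encIn | _ , e' , encOut =
  _ , τ-step (t-closeʳ d' e') ⟹-refl ,
  encodes≈-resp (≈-new ≈-comm) (close-afterBoundOut encOut encIn) (≈-new ≈-comm)
encode-τ (t-newτ d) with encode-τ d
... | _ , steps , r = _ , ⟹-new steps , encodes≈-new r
encode-τ (t-rep d) with encode-τ d
... | _ , steps , r = _ , ⟹-≈ˡ ≈-unfold steps , r

Outputs : Tm → ℕ → Set
Outputs X a = (Σ ℕ λ b → Σ Tm λ X' → X -[ freeOut a b ]→ X') ⊎ (Σ Tm λ X' → X -[ boundOut a ]→ X')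

outputs-≈ : ∀ {X X' a} → X ≈ X' → Outputs X a → Outputs X' a
outputs-≈ X≈X' (inj₁ (b , _ , d)) with ≈⇒≼ X≈X' d
... | _ , d' , _ = inj₁ (b , _ , d')
outputs-≈ X≈X' (inj₂ (_ , d)) with ≈⇒≼ X≈X' d
... | _ , d' , _ = inj₂ (_ , d')

encodes≈-τˡ : ∀ {X Y X'} → Encodes≈ X Y → X -[ τ ]→ X' → Σ Tm λ Y' → (Y ⟹ Y') × Encodes≈ X' Y'
encodes≈-τˡ (_ , _ , X≈X₀ , enc , Y₀≈Y) d with ≈⇒≼ X≈X₀ d
... | _ , d₀ , X'≈X₀' with encodes-τ enc d₀
... | idle r = _ , ⟹-refl , encodes≈-resp X'≈X₀' r Y₀≈Y
... | follow e r with ≈⇒≼ Y₀≈Y e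
... | Y' , e' , Y₀'≈Y' = Y' , τ-step e' ⟹-refl , encodes≈-resp X'≈X₀' r Y₀'≈Y'

encodes≈-τʳ : ∀ {X Y Y'} → Encodes≈ X Y → Y -[ τ ]→ Y' → Σ Tm λ X' → (X ⟹ X') × Encodes≈ X' Y'
encodes≈-τʳ (_ , _ , X≈X₀ , enc , Y₀≈Y) d with ≈⇒≼ (≈-sym Y₀≈Y) d
... | _ , d₀ , Y'≈Y₀' with encode-τ d₀
... | X' , steps , r =
  X' , ⟹-trans (⟹-≈ˡ X≈X₀ (encodes-⟹ enc)) steps , encodes≈-resp ≈-refl r (≈-sym Y'≈Y₀')

encodes≈-outputsˡ : ∀ {X Y a} → Encodes≈ X Y → Outputs X a → Outputs Y a
encodes≈-outputsˡ (_ , _ , X≈X₀ , enc , Y₀≈Y) outputs with outputs-≈ X≈X₀ outputs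
... | inj₁ (_ , _ , d) = ⊥-elim (encodes-no-freeOut enc d)
... | inj₂ (_ , d) with encodes-boundOut enc d
... | byFreeOut e _ = outputs-≈ Y₀≈Y (inj₁ (_ , _ , e))
... | byBoundOut e _ = outputs-≈ Y₀≈Y (inj₂ (_ , e))

encode-outputs : ∀ {Y a} → Outputs Y a → Outputs (encode Y) a
encode-outputs (inj₁ (_ , _ , d)) with encode-freeOut d
... | _ , e , _ = inj₂ (_ , e)
encode-outputs (inj₂ (_ , d)) with encode-boundOut d
... | _ , e , _ = inj₂ (_ , e)

encodes≈-outputsʳ : ∀ {X Y a} → Encodes≈ X Y → Outputs Y a → Σ Tm λ X' → (X ⟹ X') × Outputs X' a
encodes≈-outputsʳ (_ , _ , X≈X₀ , enc , Y₀≈Y) outputs =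
  _ , ⟹-≈ˡ X≈X₀ (encodes-⟹ enc) , encode-outputs (outputs-≈ (≈-sym Y₀≈Y) outputs)


-- Translating named processes

update-here : ∀ (σ : Name → Name) y w → (σ [ y ↦ w ]) y ≡ w
update-here σ y w rewrite dec-true (y ≟ y) refl = refl

update-there : ∀ (σ : Name → Name) y w z → z ≢ y → (σ [ y ↦ w ]) z ≡ σ z
update-there σ y w z z≢y rewrite dec-false (z ≟ y) z≢y = refl

extend : (Name → ℕ) → Name → Name → ℕ
extend ρ y = (suc ∘ ρ) [ y ↦ zero ]

extend-here : ∀ ρ y → extend ρ y y ≡ zero
extend-here ρ y = update-here (suc ∘ ρ) y zero

extend-there : ∀ ρ y n → n ≢ y → extend ρ y n ≡ suc (ρ n)
extend-there ρ y n n≢y = update-there (suc ∘ ρ) y zero n n≢y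

extend-injective : ∀ {ρ} → Injective _≡_ _≡_ ρ → ∀ y → Injective _≡_ _≡_ (extend ρ y)
extend-injective {ρ} ρ-inj y {m} {n} eq with m ≟ y | n ≟ y
... | yes refl | yes refl = refl
... | yes refl | no n≢y with () ← trans (sym (extend-here ρ m)) (trans eq (extend-there ρ m n n≢y))
... | no m≢y | yes refl with () ← trans (sym (extend-here ρ n)) (trans (sym eq) (extend-there ρ n m m≢y))
... | no m≢y | no n≢y =
  ρ-inj (suc-injective (trans (sym (extend-there ρ y m m≢y)) (trans eq (extend-there ρ y n n≢y))))

toTm : (Name → ℕ) → Proc → Tm
toTm ρ 𝟎 = nil
toTm ρ (out x z P) = send (ρ x) (ρ z) (toTm ρ P)
toTm ρ (inp x y P) = recv (ρ x) (toTm (extend ρ y) P)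
toTm ρ (P ∥ Q) = toTm ρ P ∣ toTm ρ Q
toTm ρ (ν y P) = new (toTm (extend ρ y) P)
toTm ρ (! P) = rep (toTm ρ P)

remove⁺ : ∀ {n y L} → n ∈ L → n ≢ y → n ∈ remove y L
remove⁺ {y = y} = ∈-filter⁺ (λ z → ¬? (z ≟ y))

remove⁻ : ∀ {n y L} → n ∈ remove y L → n ∈ L × n ≢ y
remove⁻ {y = y} {L} = ∈-filter⁻ (λ z → ¬? (z ≟ y)) {xs = L}

≤max : ∀ {n L} → n ∈ L → n ≤ foldr _⊔_ 0 L
≤max {n} {x ∷ L} (here refl) = m≤m⊔n n (foldr _⊔_ 0 L)
≤max {n} {x ∷ L} (there n∈L) = ≤-trans (≤max n∈L) (m≤n⊔m x (foldr _⊔_ 0 L))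

<fresh : ∀ {n L} → n ∈ L → n < fresh L
<fresh n∈L = s≤s (≤max n∈L)

fresh∉ : ∀ L → fresh L ∉ L
fresh∉ L fresh∈L = <-irrefl refl (<fresh fresh∈L)

fresh∉ˡ : ∀ L₁ L₂ → fresh (L₁ ++ L₂) ∉ L₁
fresh∉ˡ L₁ L₂ = fresh∉ (L₁ ++ L₂) ∘ ∈-++⁺ˡ

fresh∉ʳ : ∀ L₁ L₂ → fresh (L₁ ++ L₂) ∉ L₂
fresh∉ʳ L₁ L₂ = fresh∉ (L₁ ++ L₂) ∘ ∈-++⁺ʳ L₁

fn⊆names : ∀ P {n} → n ∈ fn P → n ∈ names P
fn⊆names (out x z P) (here n≡x) = here n≡x
fn⊆names (out x z P) (there (here n≡z)) = there (here n≡z)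
fn⊆names (out x z P) (there (there n∈)) = there (there (fn⊆names P n∈))
fn⊆names (inp x y P) (here n≡x) = here n≡x
fn⊆names (inp x y P) (there n∈) = there (there (fn⊆names P (proj₁ (remove⁻ n∈))))
fn⊆names (P ∥ Q) n∈ with ∈-++⁻ (fn P) n∈
... | inj₁ n∈P = ∈-++⁺ˡ (fn⊆names P n∈P)
... | inj₂ n∈Q = ∈-++⁺ʳ (names P) (fn⊆names Q n∈Q)
fn⊆names (ν y P) n∈ = there (fn⊆names P (proj₁ (remove⁻ n∈)))
fn⊆names (! P) n∈ = fn⊆names P n∈

fn-fresh : ∀ {w} P {n} → w ∉ names P → n ∈ fn P → n ≢ w
fn-fresh P w∉ n∈ refl = w∉ (fn⊆names P n∈)

extend-cong : ∀ ρ ρ′ y P → (∀ n → n ∈ fn (ν y P) → ρ n ≡ ρ′ n) →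
              ∀ n → n ∈ fn P → extend ρ y n ≡ extend ρ′ y n
extend-cong ρ ρ′ y P agree n n∈ with n ≟ y
... | yes refl = trans (extend-here ρ n) (sym (extend-here ρ′ n))
... | no n≢y =
  trans (extend-there ρ y n n≢y) (trans (cong suc (agree n (remove⁺ n∈ n≢y))) (sym (extend-there ρ′ y n n≢y)))

toTm-cong : ∀ P ρ ρ′ → (∀ n → n ∈ fn P → ρ n ≡ ρ′ n) → toTm ρ P ≡ toTm ρ′ P
toTm-cong 𝟎 ρ ρ′ agree = refl
toTm-cong (out x z P) ρ ρ′ agree
  rewrite agree x (here refl) | agree z (there (here refl)) =
  cong (send _ _) (toTm-cong P ρ ρ′ (λ n → agree n ∘ there ∘ there))
toTm-cong (inp x y P) ρ ρ′ agree =
  cong₂ recv (agree x (here refl)) (toTm-cong P _ _ (extend-cong ρ ρ′ y P (λ n → agree n ∘ there)))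
toTm-cong (P ∥ Q) ρ ρ′ agree =
  cong₂ _∣_ (toTm-cong P ρ ρ′ (λ n → agree n ∘ ∈-++⁺ˡ)) (toTm-cong Q ρ ρ′ (λ n → agree n ∘ ∈-++⁺ʳ (fn P)))
toTm-cong (ν y P) ρ ρ′ agree = cong new (toTm-cong P _ _ (extend-cong ρ ρ′ y P agree))
toTm-cong (! P) ρ ρ′ agree = cong rep (toTm-cong P ρ ρ′ agree)

toTm-≗ : ∀ P {ρ ρ′} → ρ ≗ ρ′ → toTm ρ P ≡ toTm ρ′ P
toTm-≗ P {ρ} {ρ′} ρ≗ρ′ = toTm-cong P ρ ρ′ (λ n _ → ρ≗ρ′ n)

lift-extend : ∀ f ρ y → (lift f ∘ extend ρ y) ≗ extend (f ∘ ρ) y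
lift-extend f ρ y n with n ≟ y
... | yes refl = trans (cong (lift f) (extend-here ρ n)) (sym (extend-here (f ∘ ρ) n))
... | no n≢y = trans (cong (lift f) (extend-there ρ y n n≢y)) (sym (extend-there (f ∘ ρ) y n n≢y))

ren-toTm : ∀ f ρ P → ren f (toTm ρ P) ≡ toTm (f ∘ ρ) P
ren-toTm f ρ 𝟎 = refl
ren-toTm f ρ (out x z P) = cong (send _ _) (ren-toTm f ρ P)
ren-toTm f ρ (inp x y P) = cong (recv _) (trans (ren-toTm (lift f) (extend ρ y) P) (toTm-≗ P (lift-extend f ρ y)))
ren-toTm f ρ (P ∥ Q) = cong₂ _∣_ (ren-toTm f ρ P) (ren-toTm f ρ Q)
ren-toTm f ρ (ν y P) = cong new (trans (ren-toTm (lift f) (extend ρ y) P) (toTm-≗ P (lift-extend f ρ y)))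
ren-toTm f ρ (! P) = cong rep (ren-toTm f ρ P)

toTm-fresh : ∀ ρ w P → w ∉ names P → toTm (extend ρ w) P ≡ shift (toTm ρ P)
toTm-fresh ρ w P w∉ =
  trans (toTm-cong P _ (suc ∘ ρ) (λ n n∈ → extend-there ρ w n (fn-fresh P w∉ n∈))) (sym (ren-toTm suc ρ P))

binder-avoids : ∀ σ y P n → n ∈ fn P → n ≢ y → σ n ≢ binder σ y P
binder-avoids σ y P n n∈ n≢y = avoids (y ∈? images)
  where
  images = map σ (remove y (fn P))
  σn∈ : σ n ∈ images
  σn∈ = ∈-map⁺ σ (remove⁺ n∈ n≢y)
  avoids : (y∈? : Dec (y ∈ images)) → σ n ≢ (if does y∈? then fresh (images ++ names P) else y)
  avoids (yes _) eq = fresh∉ (images ++ names P) (subst (_∈ (images ++ names P)) eq (∈-++⁺ˡ σn∈))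
  avoids (no y∉) eq = y∉ (subst (_∈ images) eq σn∈)

extend-binder : ∀ ρ σ y P n → n ∈ fn P →
                extend ρ (binder σ y P) ((σ [ y ↦ binder σ y P ]) n) ≡ extend (ρ ∘ σ) y n
extend-binder ρ σ y P n n∈ with n ≟ y
... | yes refl = begin
  extend ρ y′ ((σ [ n ↦ y′ ]) n) ≡⟨ cong (extend ρ y′) (update-here σ n y′) ⟩
  extend ρ y′ y′                 ≡⟨ extend-here ρ y′ ⟩
  zero                           ≡⟨ extend-here (ρ ∘ σ) n ⟨
  extend (ρ ∘ σ) n n             ∎
  where open ≡-Reasoning
        y′ = binder σ n P
... | no n≢y = begin
  extend ρ y′ ((σ [ y ↦ y′ ]) n) ≡⟨ cong (extend ρ y′) (update-there σ y y′ n n≢y) ⟩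
  extend ρ y′ (σ n)              ≡⟨ extend-there ρ y′ (σ n) (binder-avoids σ y P n n∈ n≢y) ⟩
  suc (ρ (σ n))                  ≡⟨ extend-there (ρ ∘ σ) y n n≢y ⟨
  extend (ρ ∘ σ) y n             ∎
  where open ≡-Reasoning
        y′ = binder σ y P

toTm-sub : ∀ σ ρ P → toTm ρ (sub σ P) ≡ toTm (ρ ∘ σ) P
toTm-sub σ ρ 𝟎 = refl
toTm-sub σ ρ (out x z P) = cong (send _ _) (toTm-sub σ ρ P)
toTm-sub σ ρ (inp x y P) =
  cong (recv _) (trans (toTm-sub (σ [ y ↦ binder σ y P ]) _ P) (toTm-cong P _ _ (extend-binder ρ σ y P)))
toTm-sub σ ρ (P ∥ Q) = cong₂ _∣_ (toTm-sub σ ρ P) (toTm-sub σ ρ Q)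
toTm-sub σ ρ (ν y P) =
  cong new (trans (toTm-sub (σ [ y ↦ binder σ y P ]) _ P) (toTm-cong P _ _ (extend-binder ρ σ y P)))
toTm-sub σ ρ (! P) = cong rep (toTm-sub σ ρ P)

toTm-α : ∀ ρ y w P → w ∉ names P → toTm (extend ρ w) (P [ w / y ]) ≡ toTm (extend ρ y) P
toTm-α ρ y w P w∉ = trans (toTm-sub (id [ y ↦ w ]) (extend ρ w) P) (toTm-cong P _ _ renamed)
  where
  renamed : ∀ n → n ∈ fn P → extend ρ w ((id [ y ↦ w ]) n) ≡ extend ρ y n
  renamed n n∈ with n ≟ y
  ... | yes refl = trans (cong (extend ρ w) (update-here id n w)) (trans (extend-here ρ w) (sym (extend-here ρ n)))
  ... | no n≢y = trans (cong (extend ρ w) (update-there id y w n n≢y))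
                       (trans (extend-there ρ w n (fn-fresh P w∉ n∈)) (sym (extend-there ρ y n n≢y)))

sub₀-toTm : ∀ ρ z y Q → ren (sub₀ (ρ z)) (toTm (extend ρ y) Q) ≡ toTm ρ (Q [ z / y ])
sub₀-toTm ρ z y Q =
  trans (ren-toTm (sub₀ (ρ z)) (extend ρ y) Q) (trans (toTm-≗ Q instantiate) (sym (toTm-sub (id [ y ↦ z ]) ρ Q)))
  where
  instantiate : (sub₀ (ρ z) ∘ extend ρ y) ≗ (ρ ∘ (id [ y ↦ z ]))
  instantiate n with n ≟ y
  ... | yes refl = trans (cong (sub₀ (ρ z)) (extend-here ρ n)) (cong ρ (sym (update-here id n z)))
  ... | no n≢y = trans (cong (sub₀ (ρ z)) (extend-there ρ y n n≢y)) (cong ρ (sym (update-there id y z n n≢y)))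

swap-extend : ∀ ρ y u → y ≢ u → (swap ∘ extend (extend ρ y) u) ≗ extend (extend ρ u) y
swap-extend ρ y u y≢u n with n ≟ u | n ≟ y
... | yes refl | yes refl = ⊥-elim (y≢u refl)
... | yes refl | no n≢y =
  trans (cong swap (extend-here (extend ρ y) n))
        (sym (trans (extend-there (extend ρ n) y n n≢y) (cong suc (extend-here ρ n))))
... | no n≢u | yes refl =
  trans (cong swap (trans (extend-there (extend ρ n) u n n≢u) (cong suc (extend-here ρ n))))
        (sym (extend-here (extend ρ u) n))
... | no n≢u | no n≢y =
  trans (cong swap (trans (extend-there (extend ρ y) u n n≢u) (cong suc (extend-there ρ y n n≢y))))
        (sym (trans (extend-there (extend ρ u) y n n≢y) (cong suc (extend-there ρ u n n≢u))))

toTm-≡π : ∀ ρ {P Q} → P ≡π Q → toTm ρ P ≈ toTm ρ Q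
toTm-≡π ρ refl≡ = ≈-refl
toTm-≡π ρ (sym≡ P≡Q) = ≈-sym (toTm-≡π ρ P≡Q)
toTm-≡π ρ (trans≡ P≡Q Q≡R) = toTm-≡π ρ P≡Q ⟫ toTm-≡π ρ Q≡R
toTm-≡π ρ (c-out P≡Q) = ≈-send (toTm-≡π ρ P≡Q)
toTm-≡π ρ (c-inp {y = y} P≡Q) = ≈-recv (toTm-≡π (extend ρ y) P≡Q)
toTm-≡π ρ (c-par P≡P′ Q≡Q′) = ≈-par (toTm-≡π ρ P≡P′) (toTm-≡π ρ Q≡Q′)
toTm-≡π ρ (c-res {y} P≡Q) = ≈-new (toTm-≡π (extend ρ y) P≡Q)
toTm-≡π ρ (c-bang P≡Q) = ≈-rep (toTm-≡π ρ P≡Q)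
toTm-≡π ρ par-assoc = ≈-assoc
toTm-≡π ρ par-comm = ≈-comm
toTm-≡π ρ par-nil = ≈-nil
toTm-≡π ρ bang-unf = ≈-unfold
toTm-≡π ρ res-nil = ≈-newNil
toTm-≡π ρ (res-swap {y} {u} {P}) with y ≟ u
... | yes refl = ≈-refl
... | no y≢u =
  ≈-newSwap ⟫ ≡→≈ (cong (new ∘ new) (trans (ren-toTm swap _ P) (toTm-≗ P (swap-extend ρ y u y≢u))))
toTm-≡π ρ (res-par {w} {P} {Q} w∉) =
  ≡→≈ (cong (λ R → new (R ∣ toTm (extend ρ w) Q)) (toTm-fresh ρ w P w∉)) ⟫ ≈-extrude
toTm-≡π ρ (alpha-res {y} {w} {P} w∉) = ≡→≈ (cong new (sym (toTm-α ρ y w P w∉)))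
toTm-≡π ρ (alpha-inp {y = y} {w} {P} w∉) = ≡→≈ (cong (recv _) (sym (toTm-α ρ y w P w∉)))

extend²-below : ∀ ρ u {n} → n < u → extend (extend ρ u) (suc u) n ≡ suc² (ρ n)
extend²-below ρ u {n} n<u =
  trans (extend-there (extend ρ u) (suc u) n (<⇒≢ (m<n⇒m<1+n n<u))) (cong suc (extend-there ρ u n (<⇒≢ n<u)))

-- The names u and suc u bound by TB lie above every name of the source, so below the two
-- new binders the translation of the source is shifted by two.
toTm-TB : ∀ ρ P → toTm ρ (TB P) ≡ encode (toTm ρ P)
toTm-TB ρ 𝟎 = refl
toTm-TB ρ (out x z P) =
  encoded-send (extend-there ρ u x (<⇒≢ (below (here refl)))) (extend-here ρ u) (extend-here ρ u)
               (extend-here (extend ρ u) (suc u)) (extend²-below ρ u (below (there (here refl))))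
               continuation
  where
  u = fresh (x ∷ z ∷ names P)
  ρ₂ = extend (extend ρ u) (suc u)
  below : ∀ {n} → n ∈ x ∷ z ∷ names P → n < u
  below = <fresh
  shifted : ∀ n → n ∈ fn P → ρ₂ n ≡ suc² (ρ n)
  shifted n n∈ = extend²-below ρ u (below (there (there (fn⊆names P n∈))))
  continuation : toTm ρ₂ (TB P) ≡ ren suc² (encode (toTm ρ P))
  continuation = begin
    toTm ρ₂ (TB P)               ≡⟨ toTm-TB ρ₂ P ⟩
    encode (toTm ρ₂ P)           ≡⟨ cong encode (toTm-cong P ρ₂ (suc² ∘ ρ) shifted) ⟩
    encode (toTm (suc² ∘ ρ) P)   ≡⟨ cong encode (ren-toTm suc² ρ P) ⟨
    encode (ren suc² (toTm ρ P)) ≡⟨ encode-ren suc² (toTm ρ P) ⟨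
    ren suc² (encode (toTm ρ P)) ∎
    where open ≡-Reasoning
  encoded-send : ∀ {a a′ b b′ c c′ d d′ e e′ T T′} →
                 a ≡ a′ → b ≡ b′ → c ≡ c′ → d ≡ d′ → e ≡ e′ → T ≡ T′ →
                 new (send a b nil ∣ recv c (send d e nil ∣ T)) ≡ new (send a′ b′ nil ∣ recv c′ (send d′ e′ nil ∣ T′))
  encoded-send refl refl refl refl refl refl = refl
toTm-TB ρ (inp x y P) =
  encoded-recv (trans (extend-there (extend ρ u) (suc u) u (1+n≢n ∘ sym)) (cong suc (extend-here ρ u)))
               (extend-here (extend ρ u) (suc u)) (extend-here (extend ρ u) (suc u))
               continuation
  where
  u = fresh (x ∷ y ∷ names P)
  ρ₂ = extend (extend ρ u) (suc u)
  below : ∀ {n} → n ∈ x ∷ y ∷ names P → n < u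
  below = <fresh
  shifted : ∀ n → n ∈ fn P → extend ρ₂ y n ≡ lift suc² (extend ρ y n)
  shifted n n∈ with n ≟ y
  ... | yes refl = trans (extend-here ρ₂ n) (sym (cong (lift suc²) (extend-here ρ n)))
  ... | no n≢y = begin
    extend ρ₂ y n            ≡⟨ extend-there ρ₂ y n n≢y ⟩
    suc (ρ₂ n)               ≡⟨ cong suc (extend²-below ρ u (below (there (there (fn⊆names P n∈))))) ⟩
    suc² (suc (ρ n))         ≡⟨ cong (lift suc²) (extend-there ρ y n n≢y) ⟨
    lift suc² (extend ρ y n) ∎
    where open ≡-Reasoning
  continuation : toTm (extend ρ₂ y) (TB P) ≡ ren (lift suc²) (encode (toTm (extend ρ y) P))
  continuation = begin
    toTm (extend ρ₂ y) (TB P)                      ≡⟨ toTm-TB (extend ρ₂ y) P ⟩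
    encode (toTm (extend ρ₂ y) P)                  ≡⟨ cong encode (toTm-cong P _ _ shifted) ⟩
    encode (toTm (lift suc² ∘ extend ρ y) P)       ≡⟨ cong encode (ren-toTm (lift suc²) (extend ρ y) P) ⟨
    encode (ren (lift suc²) (toTm (extend ρ y) P)) ≡⟨ encode-ren (lift suc²) _ ⟨
    ren (lift suc²) (encode (toTm (extend ρ y) P)) ∎
    where open ≡-Reasoning
  encoded-recv : ∀ {a a′ b b′ c c′ T T′} → a ≡ a′ → b ≡ b′ → c ≡ c′ → T ≡ T′ →
                 recv (ρ x) (new (send a b nil ∣ recv c T)) ≡ recv (ρ x) (new (send a′ b′ nil ∣ recv c′ T′))
  encoded-recv refl refl refl refl = refl
toTm-TB ρ (P ∥ Q) = cong₂ _∣_ (toTm-TB ρ P) (toTm-TB ρ Q)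
toTm-TB ρ (ν y P) = cong new (toTm-TB (extend ρ y) P)
toTm-TB ρ (! P) = cong rep (toTm-TB ρ P)

-- Reductions and barbs through the translation

toTm-⟼ : ∀ ρ {P P'} → P ⟼ P' → Σ Tm λ X → (toTm ρ P -[ τ ]→ X) × (X ≈ toTm ρ P')
toTm-⟼ ρ (comm {z = z} {y} {P} {Q}) = _ , t-commˡ t-send t-recv , ≡→≈ (cong (toTm ρ P ∣_) (sub₀-toTm ρ z y Q))
toTm-⟼ ρ (r-par d) with toTm-⟼ ρ d
... | _ , t , X≈ = _ , t-parˡ t , ≈-par X≈ ≈-refl
toTm-⟼ ρ (r-res {y} d) with toTm-⟼ (extend ρ y) d
... | _ , t , X≈ = _ , t-newτ t , ≈-new X≈
toTm-⟼ ρ (r-str P≡ d ≡Q) with toTm-⟼ ρ d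
... | _ , t , X≈ with ≈⇒≼ (≈-sym (toTm-≡π ρ P≡)) t
... | _ , t′ , X≈X′ = _ , t′ , ≈-sym X≈X′ ⟫ X≈ ⟫ toTm-≡π ρ ≡Q

Reduces : (Name → ℕ) → Proc → Tm → Set
Reduces ρ P X = Σ Proc λ P' → (P ⟼ P') × (toTm ρ P' ≈ X)

reduces-≈ : ∀ {ρ P X X'} → Reduces ρ P X → X ≈ X' → Reduces ρ P X'
reduces-≈ (P' , st , P'≈X) X≈X' = P' , st , P'≈X ⟫ X≈X'

reduces-≡π : ∀ {ρ P Q X} → P ≡π Q → Reduces ρ Q X → Reduces ρ P X
reduces-≡π P≡Q (Q' , st , Q'≈X) = Q' , r-str P≡Q st refl≡ , Q'≈X

reduces-∥ˡ : ∀ {ρ P Q X} → Reduces ρ P X → Reduces ρ (P ∥ Q) (X ∣ toTm ρ Q)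
reduces-∥ˡ (P' , st , P'≈X) = P' ∥ _ , r-par st , ≈-par P'≈X ≈-refl

reduces-∥ʳ : ∀ {ρ P Q X} → Reduces ρ Q X → Reduces ρ (P ∥ Q) (toTm ρ P ∣ X)
reduces-∥ʳ (Q' , st , Q'≈X) = _ ∥ Q' , r-str par-comm (r-par st) par-comm , ≈-par ≈-refl Q'≈X

reduces-ν : ∀ {ρ y P X} → Reduces (extend ρ y) P X → Reduces ρ (ν y P) (new X)
reduces-ν (P' , st , P'≈X) = ν _ P' , r-res st , ≈-new P'≈X

input-fresh : ∀ ρ w C {a Y} → w ∉ names C → toTm ρ C -[ input a ]→ Y →
              toTm (extend ρ w) C -[ input (suc a) ]→ ren (lift suc) Y
input-fresh ρ w C w∉ d = subst (_-[ _ ]→ _) (sym (toTm-fresh ρ w C w∉)) (step-ren suc d)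

α-extrude : ∀ {B C w y} → w ∉ names B → w ∉ names C → (ν y B ∥ C) ≡π ν w (B [ w / y ] ∥ C)
α-extrude w∉B w∉C =
  trans≡ (c-par (alpha-res w∉B) refl≡) (trans≡ par-comm (trans≡ (sym≡ (res-par w∉C)) (c-res par-comm)))

-- The translation is taken at an equation toTm ρ B ≡ T so that the transition can be
-- inverted by matching on B; ρ is injective so that a channel determines a name.
reduce-input : ∀ {ρ} → Injective _≡_ _≡_ ρ → ∀ B {T a X} → toTm ρ B ≡ T → T -[ input a ]→ X →
               ∀ x z P → ρ x ≡ a → Reduces ρ (out x z P ∥ B) (toTm ρ P ∣ ren (sub₀ (ρ z)) X)
reduce-input ρ-inj (inp x′ y Q) refl t-recv x z P ρx≡ρx′ with refl ← ρ-inj ρx≡ρx′ =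
  _ , comm , ≡→≈ (cong (toTm _ P ∣_) (sym (sub₀-toTm _ z y Q)))
reduce-input {ρ} ρ-inj (B₁ ∥ B₂) refl (t-parˡ d) x z P ρx≡a =
  reduces-≈ (reduces-≡π par-assoc (reduces-∥ˡ (reduce-input ρ-inj B₁ refl d x z P ρx≡a)))
    (≈-sym ≈-assoc ⟫ ≈-par ≈-refl (≈-par ≈-refl (≡→≈ (sym (sub₀-shift _ (toTm ρ B₂))))))
reduce-input {ρ} ρ-inj (B₁ ∥ B₂) refl (t-parʳ d) x z P ρx≡a =
  reduces-≈ (reduces-≡π (trans≡ par-assoc (trans≡ (c-par par-comm refl≡) (sym≡ par-assoc)))
                        (reduces-∥ʳ (reduce-input ρ-inj B₂ refl d x z P ρx≡a)))
    (≈-assoc ⟫ ≈-par ≈-comm ≈-refl ⟫ ≈-sym ≈-assoc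
     ⟫ ≈-par ≈-refl (≈-par (≡→≈ (sym (sub₀-shift _ (toTm ρ B₁)))) ≈-refl))
reduce-input {ρ} ρ-inj (ν y B) refl (t-newIn {P' = X} d) x z P ρx≡a =
  reduces-≈ (reduces-≡π (trans≡ (c-par refl≡ (alpha-res w∉B)) (sym≡ (res-par w∉out)))
                        (reduces-ν (reduce-input (extend-injective ρ-inj w) (B [ w / y ]) (toTm-α ρ y w B w∉B) d
                                                 x z P (trans (extend-there ρ w x x≢w) (cong suc ρx≡a)))))
    (≡→≈ (cong new (cong₂ _∣_ (toTm-fresh ρ w P (w∉out ∘ there ∘ there))
                              (cong (λ c → ren (sub₀ c) X) (extend-there ρ w z (w∉out ∘ there ∘ here ∘ sym)))))
     ⟫ ≈-extrude ⟫ ≈-par ≈-refl (≡→≈ (cong new (sym (ren-fuse X (lift-sub₀-swap (ρ z)))))))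
  where
  w = fresh (names B ++ names (out x z P))
  w∉B = fresh∉ˡ (names B) (names (out x z P))
  w∉out = fresh∉ʳ (names B) (names (out x z P))
  x≢w : x ≢ w
  x≢w = w∉out ∘ here ∘ sym
reduce-input ρ-inj (! B) refl (t-rep d) x z P ρx≡a =
  reduces-≡π (c-par refl≡ bang-unf) (reduce-input ρ-inj (B ∥ ! B) refl d x z P ρx≡a)

reduce-freeOut : ∀ {ρ} → Injective _≡_ _≡_ ρ → ∀ B {T a b X} → toTm ρ B ≡ T → T -[ freeOut a b ]→ X →
                 ∀ C {Y} → toTm ρ C -[ input a ]→ Y → Reduces ρ (B ∥ C) (X ∣ ren (sub₀ b) Y)
reduce-freeOut ρ-inj (out x z P) refl t-send C e = reduce-input ρ-inj C refl e x z P refl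
reduce-freeOut ρ-inj (B₁ ∥ B₂) refl (t-parˡ d) C e =
  reduces-≈ (reduces-≡π (trans≡ (sym≡ par-assoc) (trans≡ (c-par refl≡ par-comm) par-assoc))
                        (reduces-∥ˡ (reduce-freeOut ρ-inj B₁ refl d C e)))
    (≈-sym ≈-assoc ⟫ ≈-par ≈-refl ≈-comm ⟫ ≈-assoc)
reduce-freeOut ρ-inj (B₁ ∥ B₂) refl (t-parʳ d) C e =
  reduces-≈ (reduces-≡π (sym≡ par-assoc) (reduces-∥ʳ (reduce-freeOut ρ-inj B₂ refl d C e))) ≈-assoc
reduce-freeOut {ρ} ρ-inj (ν y B) {b = b} refl (t-newOut {P' = X} d) C {Y} e =
  reduces-≈ (reduces-≡π (α-extrude w∉B w∉C)
                        (reduces-ν (reduce-freeOut (extend-injective ρ-inj w) (B [ w / y ]) (toTm-α ρ y w B w∉B) d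
                                                   C (input-fresh ρ w C w∉C e))))
    (≡→≈ (cong (λ R → new (X ∣ R)) (ren-square Y (sub₀-suc-lift-suc b))) ⟫ ≈-new ≈-comm ⟫ ≈-extrude ⟫ ≈-comm)
  where
  w = fresh (names B ++ names C)
  w∉B = fresh∉ˡ (names B) (names C)
  w∉C = fresh∉ʳ (names B) (names C)
reduce-freeOut ρ-inj (! B) refl (t-rep d) C e =
  reduces-≡π (c-par bang-unf refl≡) (reduce-freeOut ρ-inj (B ∥ ! B) refl d C e)

reduce-boundOut : ∀ {ρ} → Injective _≡_ _≡_ ρ → ∀ B {T a X} → toTm ρ B ≡ T → T -[ boundOut a ]→ X →
                  ∀ C {Y} → toTm ρ C -[ input a ]→ Y → Reduces ρ (B ∥ C) (new (X ∣ Y))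
reduce-boundOut ρ-inj (B₁ ∥ B₂) refl (t-parˡ d) C e =
  reduces-≈ (reduces-≡π (trans≡ (sym≡ par-assoc) (trans≡ (c-par refl≡ par-comm) par-assoc))
                        (reduces-∥ˡ (reduce-boundOut ρ-inj B₁ refl d C e)))
    (≈-sym extrude-middleˡ)
reduce-boundOut ρ-inj (B₁ ∥ B₂) refl (t-parʳ d) C e =
  reduces-≈ (reduces-≡π (sym≡ par-assoc) (reduces-∥ʳ (reduce-boundOut ρ-inj B₂ refl d C e))) (≈-sym extrude-first)
reduce-boundOut {ρ} ρ-inj (ν y B) refl (t-open {P' = X} d) C {Y} e =
  reduces-≈ (reduces-≡π (α-extrude w∉B w∉C)
                        (reduces-ν (reduce-freeOut (extend-injective ρ-inj w) (B [ w / y ]) (toTm-α ρ y w B w∉B) d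
                                                   C (input-fresh ρ w C w∉C e))))
    (≈-new (≡→≈ (cong (X ∣_) (ren-cancel Y sub₀-zero-lift-suc))))
  where
  w = fresh (names B ++ names C)
  w∉B = fresh∉ˡ (names B) (names C)
  w∉C = fresh∉ʳ (names B) (names C)
reduce-boundOut {ρ} ρ-inj (ν y B) refl (t-newBoundOut {P' = X} d) C {Y} e =
  reduces-≈ (reduces-≡π (α-extrude w∉B w∉C)
                        (reduces-ν (reduce-boundOut (extend-injective ρ-inj w) (B [ w / y ]) (toTm-α ρ y w B w∉B) d
                                                    C (input-fresh ρ w C w∉C e))))
    (≈-sym (new-pullˡ X Y))
  where
  w = fresh (names B ++ names C)
  w∉B = fresh∉ˡ (names B) (names C)
  w∉C = fresh∉ʳ (names B) (names C)
reduce-boundOut ρ-inj (! B) refl (t-rep d) C e =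
  reduces-≡π (c-par bang-unf refl≡) (reduce-boundOut ρ-inj (B ∥ ! B) refl d C e)

τ⇒⟼ : ∀ {ρ} → Injective _≡_ _≡_ ρ → ∀ B {T X} → toTm ρ B ≡ T → T -[ τ ]→ X → Reduces ρ B X
τ⇒⟼ ρ-inj (B₁ ∥ B₂) refl (t-parˡ d) = reduces-∥ˡ (τ⇒⟼ ρ-inj B₁ refl d)
τ⇒⟼ ρ-inj (B₁ ∥ B₂) refl (t-parʳ d) = reduces-∥ʳ (τ⇒⟼ ρ-inj B₂ refl d)
τ⇒⟼ ρ-inj (B₁ ∥ B₂) refl (t-commˡ d e) = reduce-freeOut ρ-inj B₁ refl d B₂ e
τ⇒⟼ ρ-inj (B₁ ∥ B₂) refl (t-commʳ d e) = reduces-≈ (reduces-≡π par-comm (reduce-freeOut ρ-inj B₂ refl e B₁ d)) ≈-comm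
τ⇒⟼ ρ-inj (B₁ ∥ B₂) refl (t-closeˡ d e) = reduce-boundOut ρ-inj B₁ refl d B₂ e
τ⇒⟼ ρ-inj (B₁ ∥ B₂) refl (t-closeʳ d e) =
  reduces-≈ (reduces-≡π par-comm (reduce-boundOut ρ-inj B₂ refl e B₁ d)) (≈-new ≈-comm)
τ⇒⟼ ρ-inj (ν y B) refl (t-newτ d) = reduces-ν (τ⇒⟼ (extend-injective ρ-inj y) B refl d)
τ⇒⟼ ρ-inj (! B) refl (t-rep d) = reduces-≡π bang-unf (τ⇒⟼ ρ-inj (B ∥ ! B) refl d)

⟹⇒⟼* : ∀ B {X Y} → toTm id B ≈ X → X ⟹ Y → Σ Proc λ B' → (B ⟼* B') × (toTm id B' ≈ Y)
⟹⇒⟼* B B≈X (done X≈Y) = B , ε , B≈X ⟫ X≈Y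
⟹⇒⟼* B B≈X (τ-step d steps) with ≈⇒≼ (≈-sym B≈X) d
... | _ , d′ , X′≈ with τ⇒⟼ (λ eq → eq) B refl d′
... | B₁ , st , B₁≈ with ⟹⇒⟼* B₁ (B₁≈ ⟫ ≈-sym X′≈) steps
... | B' , sts , B'≈Y = B' , st ◅ sts , B'≈Y

outputs-new : ∀ {X a} → Outputs X (suc a) → Outputs (new X) a
outputs-new (inj₁ (zero , _ , d)) = inj₂ (_ , t-open d)
outputs-new (inj₁ (suc b , _ , d)) = inj₁ (b , _ , t-newOut d)
outputs-new (inj₂ (_ , d)) = inj₂ (_ , t-newBoundOut d)

outputs-parˡ : ∀ {X Y a} → Outputs X a → Outputs (X ∣ Y) a
outputs-parˡ (inj₁ (b , _ , d)) = inj₁ (b , _ , t-parˡ d)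
outputs-parˡ (inj₂ (_ , d)) = inj₂ (_ , t-parˡ d)

outputs-parʳ : ∀ {X Y a} → Outputs Y a → Outputs (X ∣ Y) a
outputs-parʳ (inj₁ (b , _ , d)) = inj₁ (b , _ , t-parʳ d)
outputs-parʳ (inj₂ (_ , d)) = inj₂ (_ , t-parʳ d)

outputs-rep : ∀ {X a} → Outputs X a → Outputs (rep X) a
outputs-rep (inj₁ (b , _ , d)) = inj₁ (b , _ , t-rep (t-parˡ d))
outputs-rep (inj₂ (_ , d)) = inj₂ (_ , t-rep (t-parˡ d))

toTm-barb : ∀ ρ {P x} → P ↓ x → Outputs (toTm ρ P) (ρ x)
toTm-barb ρ b-out = inj₁ (_ , _ , t-send)
toTm-barb ρ (b-parl P↓) = outputs-parˡ (toTm-barb ρ P↓)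
toTm-barb ρ (b-parr Q↓) = outputs-parʳ (toTm-barb ρ Q↓)
toTm-barb ρ (b-res {y} {P} {x} y≢x P↓) =
  outputs-new (subst (Outputs (toTm (extend ρ y) P)) (extend-there ρ y x (y≢x ∘ sym)) (toTm-barb (extend ρ y) P↓))
toTm-barb ρ (b-bang P↓) = outputs-rep (toTm-barb ρ P↓)

BarbAt : (Name → ℕ) → Proc → ℕ → Set
BarbAt ρ P a = Σ Name λ x → (ρ x ≡ a) × (P ↓ x)

barbAt-ν : ∀ ρ y P {a} → BarbAt (extend ρ y) P (suc a) → BarbAt ρ (ν y P) a
barbAt-ν ρ y P (x , ρx≡ , P↓) with x ≟ y
... | yes refl with () ← trans (sym (extend-here ρ x)) ρx≡
... | no x≢y = x , suc-injective (trans (sym (extend-there ρ y x x≢y)) ρx≡) , b-res (x≢y ∘ sym) P↓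

barbAt-! : ∀ {ρ P a} → BarbAt ρ (P ∥ ! P) a → BarbAt ρ (! P) a
barbAt-! (x , ρx≡ , b-parl P↓) = x , ρx≡ , b-bang P↓
barbAt-! (x , ρx≡ , b-parr !P↓) = x , ρx≡ , !P↓

barbAt-∥ˡ : ∀ {ρ P Q a} → BarbAt ρ P a → BarbAt ρ (P ∥ Q) a
barbAt-∥ˡ (x , ρx≡ , P↓) = x , ρx≡ , b-parl P↓

barbAt-∥ʳ : ∀ {ρ P Q a} → BarbAt ρ Q a → BarbAt ρ (P ∥ Q) a
barbAt-∥ʳ (x , ρx≡ , Q↓) = x , ρx≡ , b-parr Q↓

freeOut-barbAt : ∀ ρ B {T a b X} → toTm ρ B ≡ T → T -[ freeOut a b ]→ X → BarbAt ρ B a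
freeOut-barbAt ρ (out x z P) refl t-send = x , refl , b-out
freeOut-barbAt ρ (P ∥ Q) refl (t-parˡ d) = barbAt-∥ˡ (freeOut-barbAt ρ P refl d)
freeOut-barbAt ρ (P ∥ Q) refl (t-parʳ d) = barbAt-∥ʳ (freeOut-barbAt ρ Q refl d)
freeOut-barbAt ρ (ν y P) refl (t-newOut d) = barbAt-ν ρ y P (freeOut-barbAt (extend ρ y) P refl d)
freeOut-barbAt ρ (! P) refl (t-rep d) = barbAt-! (freeOut-barbAt ρ (P ∥ ! P) refl d)

boundOut-barbAt : ∀ ρ B {T a X} → toTm ρ B ≡ T → T -[ boundOut a ]→ X → BarbAt ρ B a
boundOut-barbAt ρ (P ∥ Q) refl (t-parˡ d) = barbAt-∥ˡ (boundOut-barbAt ρ P refl d)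
boundOut-barbAt ρ (P ∥ Q) refl (t-parʳ d) = barbAt-∥ʳ (boundOut-barbAt ρ Q refl d)
boundOut-barbAt ρ (ν y P) refl (t-newBoundOut d) = barbAt-ν ρ y P (boundOut-barbAt (extend ρ y) P refl d)
boundOut-barbAt ρ (ν y P) refl (t-open d) = barbAt-ν ρ y P (freeOut-barbAt (extend ρ y) P refl d)
boundOut-barbAt ρ (! P) refl (t-rep d) = barbAt-! (boundOut-barbAt ρ (P ∥ ! P) refl d)

toTm-barb⁻ : ∀ ρ P {a} → Outputs (toTm ρ P) a → BarbAt ρ P a
toTm-barb⁻ ρ P (inj₁ (_ , _ , d)) = freeOut-barbAt ρ P refl d
toTm-barb⁻ ρ P (inj₂ (_ , d)) = boundOut-barbAt ρ P refl d

-- The bisimulation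

-- Name is ℕ, so free names can be translated by id, which is injective as τ⇒⟼ requires.
Related : Proc → Proc → Set
Related P Q = Encodes≈ (toTm id P) (toTm id Q) ⊎ Encodes≈ (toTm id Q) (toTm id P)

related-sym : ∀ {P Q} → Related P Q → Related Q P
related-sym (inj₁ r) = inj₂ r
related-sym (inj₂ r) = inj₁ r

barb-id : ∀ {P a} → BarbAt id P a → P ↓ a
barb-id (_ , refl , P↓) = P↓

related-barb : ∀ {P Q x} → Related P Q → P ↓ x → Q ⇓ x
related-barb {Q = Q} (inj₁ r) P↓ = Q , ε , barb-id (toTm-barb⁻ id Q (encodes≈-outputsˡ r (toTm-barb id P↓)))
related-barb {Q = Q} (inj₂ r) P↓ with encodes≈-outputsʳ r (toTm-barb id P↓)
... | _ , steps , outputs with ⟹⇒⟼* Q ≈-refl steps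
... | Q' , sts , Q'≈ = Q' , sts , barb-id (toTm-barb⁻ id Q' (outputs-≈ (≈-sym Q'≈) outputs))

related-step : ∀ {P Q P'} → Related P Q → P ⟼ P' → ∃ λ Q' → Q ⟼* Q' × Related P' Q'
related-step {Q = Q} (inj₁ r) st with toTm-⟼ id st
... | _ , t , X≈ with encodes≈-τˡ r t
... | _ , steps , r' with ⟹⇒⟼* Q ≈-refl steps
... | Q' , sts , Q'≈ = Q' , sts , inj₁ (encodes≈-resp (≈-sym X≈) r' (≈-sym Q'≈))
related-step {Q = Q} (inj₂ r) st with toTm-⟼ id st
... | _ , t , X≈ with encodes≈-τʳ r t
... | _ , steps , r' with ⟹⇒⟼* Q ≈-refl steps
... | Q' , sts , Q'≈ = Q' , sts , inj₂ (encodes≈-resp Q'≈ r' X≈)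

related-isAWBB : IsAWBB Related
related-isAWBB = record { symmetric = related-sym ; barb = related-barb ; step = related-step }

corollary1 : (P : Proc) → TB P ≈AWBB P
corollary1 P =
  Related , related-isAWBB , inj₁ (encodes≈-resp (≡→≈ (toTm-TB id P)) (encodes≈-intro (encodes-encode (toTm id P))) ≈-refl)
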